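{- Let $(G,\le_G)$ be an ordered group, and let $H$ be the lattice-ordered group freely generated by $G$, with universal morphism of ordered groups $\varphi\colon G\to H$. Then $0\le_H\varphi(a)$ holds if and only if $0\le_G na$ for some integer $n\ge1$. More precisely, for $a_1,\dots,a_k,b_1,\dots,b_\ell\in G$ (with $k,\ell\ge1$), $\varphi(a_1)\wedge\dots\wedge\varphi(a_k)\le_H\varphi(b_1)\vee\dots\vee\varphi(b_\ell)$ holds if and only if there are integers $n_1,\dots,n_k,m_1,\dots,m_\ell\ge0$ with $n_1+\dots+n_k=m_1+\dots+m_\ell\ge1$ such that $n_1a_1+\dots+n_ka_k\le_G m_1b_1+\dots+m_\ell b_\ell$. Moreover, $H$ can be constructed as the Lorenzen group associated with the finest system of ideals $\rhd_{\mathrm s}$ for $G$, defined by $A\rhd_{\mathrm s}b$ iff $a\le_G b$ for some $a\in A$.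
   Context: Groups are commutative. An ordered group is a commutative group with a partial order compatible with addition; a lattice-ordered group is an ordered group whose order is a lattice and addition distributes over meet and join. The lattice-ordered group freely generated by $G$ is given by the left adjoint of the forgetful functor from lattice-ordered groups to ordered groups. $\mathrm{P}_{\mathrm{fe}}^*(G)$ denotes the nonempty finite subsets of $G$, $A-B=\{a-b\}$. A system of ideals for $G$ is a relation $\rhd$ between $\mathrm{P}_{\mathrm{fe}}^*(G)$ and $G$ with $a\rhd a$; $A\rhd b\Rightarrow A\cup A'\rhd b$; ($A\rhd c$ and $A\cup\{c\}\rhd b$) $\Rightarrow A\rhd b$; $a\le_G b\Rightarrow a\rhd b$; $A\rhd b\Rightarrow x+A\rhd x+b$. For $y_i\in G$, $\rhd_{y_1,\dots,y_n}$ is the finest system of ideals coarser than $\rhd$ with $0\rhd_{y_1,\dots,y_n} y_i$ for all $i$. The regularisation: $A\vdash_\rhd B$ iff there exist $x_1,\dots,x_m\in G$ such that $A-B\rhd_{\pm x_1,\dots,\pm x_m}0$ for every choice of signs. The Lorenzen group associated with $\rhd$ is the distributive lattice presented by generators the elements of $G$ and relations $\bigwedge A\le\bigvee B$ whenever $A\vdash_\rhd B$, equipped with the unique group law compatible with the lattice operations making $G\to H$ a group morphism. -}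

module Defs where

open import Level using (Level; _⊔_) renaming (suc to lsuc)
open import Data.Nat using (ℕ; zero; suc)
import Data.Nat as ℕ
open import Data.Fin using (Fin; zero; suc)
open import Data.Bool using (Bool; true; false)
open import Data.Product using (Σ; _×_; _,_)
open import Data.List using (List; []; _∷_; tabulate)
open import Data.List.NonEmpty using (List⁺; _∷_; [_]; _∷⁺_; toList; concatMap; foldr₁)
import Data.List.NonEmpty as L⁺
open import Data.List.Relation.Unary.Any using (Any)
open import Data.List.Membership.Propositional using (_∈_)
open import Algebra.Core using (Op₁; Op₂)
open import Algebra.Structures using (IsAbelianGroup)
open import Relation.Binary.Core using (Rel)
open import Relation.Binary.Structures using (IsPartialOrder)
open import Relation.Binary.Lattice.Structures using (IsLattice)

record IsOrderedGroup {c ℓ₁ ℓ₂} {A : Set c} (_≈_ : Rel A ℓ₁) (_≤_ : Rel A ℓ₂)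
         (_+_ : Op₂ A) (0# : A) (-_ : Op₁ A) : Set (c ⊔ ℓ₁ ⊔ ℓ₂) where
  field
    isAbelianGroup : IsAbelianGroup _≈_ _+_ 0# -_
    isPartialOrder : IsPartialOrder _≈_ _≤_
    +-mono         : ∀ {a b} c → a ≤ b → (a + c) ≤ (b + c)

record OrderedGroup c ℓ₁ ℓ₂ : Set (lsuc (c ⊔ ℓ₁ ⊔ ℓ₂)) where
  infixl 6 _+_
  infix 4 _≈_ _≤_
  field
    Carrier        : Set c
    _≈_            : Rel Carrier ℓ₁
    _≤_            : Rel Carrier ℓ₂
    _+_            : Op₂ Carrier
    0#             : Carrier
    -_             : Op₁ Carrier
    isOrderedGroup : IsOrderedGroup _≈_ _≤_ _+_ 0# -_

  _-_ : Op₂ Carrier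
  a - b = a + (- b)

  _·_ : ℕ → Carrier → Carrier
  zero  · a = 0#
  suc n · a = a + (n · a)

  ∑ : ∀ {k} → (Fin k → Carrier) → Carrier
  ∑ {zero}  f = 0#
  ∑ {suc k} f = f zero + ∑ (λ i → f (suc i))

record IsLatticeGroup {c ℓ₁ ℓ₂} {A : Set c} (_≈_ : Rel A ℓ₁) (_≤_ : Rel A ℓ₂)
         (_∧_ _∨_ : Op₂ A) (_+_ : Op₂ A) (0# : A) (-_ : Op₁ A) : Set (c ⊔ ℓ₁ ⊔ ℓ₂) where
  field
    isOrderedGroup : IsOrderedGroup _≈_ _≤_ _+_ 0# -_
    isLattice      : IsLattice _≈_ _≤_ _∨_ _∧_
    +-distrib-∧    : ∀ a b d → (a + (b ∧ d)) ≈ ((a + b) ∧ (a + d))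
    +-distrib-∨    : ∀ a b d → (a + (b ∨ d)) ≈ ((a + b) ∨ (a + d))

record LatticeGroup c ℓ₁ ℓ₂ : Set (lsuc (c ⊔ ℓ₁ ⊔ ℓ₂)) where
  infixl 6 _+_
  infixr 7 _∧_
  infixr 6 _∨_
  infix 4 _≈_ _≤_
  field
    Carrier        : Set c
    _≈_            : Rel Carrier ℓ₁
    _≤_            : Rel Carrier ℓ₂
    _∧_            : Op₂ Carrier
    _∨_            : Op₂ Carrier
    _+_            : Op₂ Carrier
    0#             : Carrier
    -_             : Op₁ Carrier
    isLatticeGroup : IsLatticeGroup _≈_ _≤_ _∧_ _∨_ _+_ 0# -_

  orderedGroup : OrderedGroup c ℓ₁ ℓ₂
  orderedGroup = record
    { Carrier = Carrier ; _≈_ = _≈_ ; _≤_ = _≤_ ; _+_ = _+_ ; 0# = 0# ; -_ = -_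
    ; isOrderedGroup = IsLatticeGroup.isOrderedGroup isLatticeGroup }

  ⋀ : ∀ {k} → (Fin (suc k) → Carrier) → Carrier
  ⋀ {zero}  f = f zero
  ⋀ {suc k} f = f zero ∧ ⋀ (λ i → f (suc i))

  ⋁ : ∀ {k} → (Fin (suc k) → Carrier) → Carrier
  ⋁ {zero}  f = f zero
  ⋁ {suc k} f = f zero ∨ ⋁ (λ i → f (suc i))

module _ {c ℓ₁ ℓ₂ c' ℓ₁' ℓ₂'} (G : OrderedGroup c ℓ₁ ℓ₂) (H : OrderedGroup c' ℓ₁' ℓ₂') where
  private
    module G = OrderedGroup G
    module H = OrderedGroup H

  record IsOrderedGroupMorphism (f : G.Carrier → H.Carrier) : Set (c ⊔ ℓ₁ ⊔ ℓ₂ ⊔ ℓ₁' ⊔ ℓ₂') where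
    field
      cong  : ∀ {a b} → a G.≈ b → f a H.≈ f b
      homo  : ∀ a b → f (a G.+ b) H.≈ (f a H.+ f b)
      mono  : ∀ {a b} → a G.≤ b → f a H.≤ f b

module _ {c ℓ₁ ℓ₂ c' ℓ₁' ℓ₂'} (G : LatticeGroup c ℓ₁ ℓ₂) (H : LatticeGroup c' ℓ₁' ℓ₂') where
  private
    module G = LatticeGroup G
    module H = LatticeGroup H

  record IsLatticeGroupMorphism (f : G.Carrier → H.Carrier) : Set (c ⊔ ℓ₁ ⊔ ℓ₂ ⊔ ℓ₁' ⊔ ℓ₂') where
    field
      isOrderedGroupMorphism : IsOrderedGroupMorphism G.orderedGroup H.orderedGroup f
      ∧-homo : ∀ a b → f (a G.∧ b) H.≈ (f a H.∧ f b)
      ∨-homo : ∀ a b → f (a G.∨ b) H.≈ (f a H.∨ f b)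

-- Freeness: (H , φ) is the lattice-ordered group freely generated by G,
-- i.e. φ is a universal arrow from G to the forgetful functor
-- (relative to lattice-ordered groups living in universe level ℓ).

IsFreeLatticeGroupOn : ∀ {ℓ} (G : OrderedGroup ℓ ℓ ℓ) (H : LatticeGroup ℓ ℓ ℓ)
                       (φ : OrderedGroup.Carrier G → LatticeGroup.Carrier H) → Set (lsuc ℓ)
IsFreeLatticeGroupOn {ℓ} G H φ =
  IsOrderedGroupMorphism G (LatticeGroup.orderedGroup H) φ ×
  ((K : LatticeGroup ℓ ℓ ℓ) (ψ : OrderedGroup.Carrier G → LatticeGroup.Carrier K) →
   IsOrderedGroupMorphism G (LatticeGroup.orderedGroup K) ψ →
   Σ (LatticeGroup.Carrier H → LatticeGroup.Carrier K) λ θ →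
     IsLatticeGroupMorphism H K θ ×
     (∀ a → LatticeGroup._≈_ K (θ (φ a)) (ψ a)) ×
     (∀ (θ' : LatticeGroup.Carrier H → LatticeGroup.Carrier K) →
        IsLatticeGroupMorphism H K θ' →
        (∀ a → LatticeGroup._≈_ K (θ' (φ a)) (ψ a)) →
        ∀ x → LatticeGroup._≈_ K (θ' x) (θ x)))

-- Systems of ideals, the relation ▷_{y₁,…,yₙ}, regularisation,
-- and the Lorenzen group.  Finite nonempty subsets of G are
-- represented by nonempty lists, membership taken up to ≈.

module Lorenzen {ℓ} (G : OrderedGroup ℓ ℓ ℓ) where
  open OrderedGroup G

  _∈≈_ : Carrier → List⁺ Carrier → Set ℓ
  x ∈≈ A = Any (λ y → x ≈ y) (toList A)

  _⊆≈_ : List⁺ Carrier → List⁺ Carrier → Set ℓ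
  A ⊆≈ A' = ∀ {x} → x ∈≈ A → x ∈≈ A'

  _⊖_ : List⁺ Carrier → List⁺ Carrier → List⁺ Carrier
  A ⊖ B = concatMap (λ a → L⁺.map (λ b → a - b) B) A

  Relation : Set (lsuc ℓ)
  Relation = List⁺ Carrier → Carrier → Set ℓ

  _▷s_ : Relation
  A ▷s b = Any (λ a → a ≤ b) (toList A)

  -- ▷_{ys}: finest system of ideals coarser than ▷ with 0 ▷ y for y ∈ ys
  -- (inductively generated closure)
  data Closure (_▷_ : Relation) (ys : List Carrier) : Relation where
    base   : ∀ {A b} → A ▷ b → Closure _▷_ ys A b
    extra  : ∀ {y} → y ∈ ys → Closure _▷_ ys [ 0# ] y
    refl   : ∀ {a} → Closure _▷_ ys [ a ] a
    weaken : ∀ {A A' b} → Closure _▷_ ys A b → A ⊆≈ A' → Closure _▷_ ys A' b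
    cut    : ∀ {A b d} → Closure _▷_ ys A d → Closure _▷_ ys (d ∷⁺ A) b → Closure _▷_ ys A b
    order  : ∀ {a b} → a ≤ b → Closure _▷_ ys [ a ] b
    shift  : ∀ {A b} x → Closure _▷_ ys A b → Closure _▷_ ys (L⁺.map (x +_) A) (x + b)

  signed : Bool → Carrier → Carrier
  signed true  x = x
  signed false x = - x

  Regularisation : Relation → List⁺ Carrier → List⁺ Carrier → Set ℓ
  Regularisation _▷_ A B =
    Σ ℕ λ m → Σ (Fin m → Carrier) λ x →
      ∀ (s : Fin m → Bool) →
        Closure _▷_ (tabulate (λ i → signed (s i) (x i))) (A ⊖ B) 0#

  infixr 7 _∧ₜ_
  infixr 6 _∨ₜ_
  data Term : Set ℓ where
    gen   : Carrier → Term
    _∧ₜ_ : Term → Term → Term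
    _∨ₜ_ : Term → Term → Term

  ⋀ₜ : List⁺ Term → Term
  ⋀ₜ = foldr₁ _∧ₜ_

  ⋁ₜ : List⁺ Term → Term
  ⋁ₜ = foldr₁ _∨ₜ_

  -- order of the distributive lattice presented by generators the elements
  -- of G and relations ⋀A ≤ ⋁B whenever A ⊢_▷ B
  data Below (_▷_ : Relation) : Term → Term → Set ℓ where
    ≼-refl  : ∀ {t} → Below _▷_ t t
    ≼-trans : ∀ {s t u} → Below _▷_ s t → Below _▷_ t u → Below _▷_ s u
    gen-≈   : ∀ {a b} → a ≈ b → Below _▷_ (gen a) (gen b)
    ∧-lb₁   : ∀ {s t} → Below _▷_ (s ∧ₜ t) s
    ∧-lb₂   : ∀ {s t} → Below _▷_ (s ∧ₜ t) t
    ∧-glb   : ∀ {s t u} → Below _▷_ u s → Below _▷_ u t → Below _▷_ u (s ∧ₜ t)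
    ∨-ub₁   : ∀ {s t} → Below _▷_ s (s ∨ₜ t)
    ∨-ub₂   : ∀ {s t} → Below _▷_ t (s ∨ₜ t)
    ∨-lub   : ∀ {s t u} → Below _▷_ s u → Below _▷_ t u → Below _▷_ (s ∨ₜ t) u
    distrib : ∀ {s t u} → Below _▷_ (s ∧ₜ (t ∨ₜ u)) ((s ∧ₜ t) ∨ₜ (s ∧ₜ u))
    rel     : ∀ {A B} → Regularisation _▷_ A B →
              Below _▷_ (⋀ₜ (L⁺.map gen A)) (⋁ₜ (L⁺.map gen B))

  Equiv : Relation → Term → Term → Set ℓ
  Equiv _▷_ s t = Below _▷_ s t × Below _▷_ t s

  record LorenzenGroupLaw (_▷_ : Relation) : Set ℓ where
    field
      _⊕_   : Op₂ Term
      zero⊕ : Term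
      neg   : Op₁ Term
      isLatticeGroup : IsLatticeGroup (Equiv _▷_) (Below _▷_) _∧ₜ_ _∨ₜ_ _⊕_ zero⊕ neg

    latticeGroup : LatticeGroup ℓ ℓ ℓ
    latticeGroup = record { isLatticeGroup = isLatticeGroup }

    field
      gen-morphism : IsOrderedGroupMorphism G (LatticeGroup.orderedGroup latticeGroup) gen

sumℕ : ∀ {k} → (Fin k → ℕ) → ℕ
sumℕ {zero}  f = 0
sumℕ {suc k} f = f zero ℕ.+ sumℕ (λ i → f (suc i))

-- Call a certificate for A ⊢ B a pair of lists of equal positive length drawn from A and B whose
-- sums satisfy Σa ≤ Σb in G.  In any lattice-ordered group such a certificate forces ⋀A ≤ ⋁B:
-- adding up the bounds gives n·⋀A ≤ n·⋁B, and lattice-ordered groups allow cancelling n.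
-- Conversely, for the finest system ▷s a derivation of A − B ▷ 0 from the extra axioms 0 ▷ ±xᵢ
-- reduces to a single inequality, and Fourier–Motzkin elimination of the xᵢ over both signs
-- leaves a certificate; so A ⊢ B holds exactly when A and B have a certificate.  Reading terms of
-- the presented lattice through their disjunctive and conjunctive normal forms, s ≤ t holds iff
-- every DNF clause of s has a certificate against every CNF clause of t.  Certificates compose by
-- the same elimination, which yields transitivity, the group law and the universal property of
-- the Lorenzen group.  Finally, freeness of H maps ⋀φ(aᵢ) ≤ ⋁φ(bⱼ) into the Lorenzen group, where
-- it becomes a certificate, i.e. the multiplicities nᵢ and mⱼ.

module Submission where

open import Defs

module OrderedGroupProperties {c ℓ₁ ℓ₂} (G : OrderedGroup c ℓ₁ ℓ₂) where
  open import Data.Nat as ℕ using (ℕ; zero; suc)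
  import Data.Nat.Properties as ℕP
  open import Data.List using (List; []; _∷_; _++_)
  open import Algebra.Bundles using (AbelianGroup)
  open import Relation.Binary.Structures using (IsPartialOrder)
  open import Relation.Binary.PropositionalEquality as P using (_≡_)

  open OrderedGroup G public
  open IsOrderedGroup isOrderedGroup public using (isAbelianGroup; isPartialOrder; +-mono)

  abGroup : AbelianGroup c ℓ₁
  abGroup = record { isAbelianGroup = isAbelianGroup }

  open AbelianGroup abGroup public using (setoid; commutativeMonoid; commutativeSemigroup)
    renaming (refl to ≈-refl; sym to ≈-sym; trans to ≈-trans; reflexive to ≈-reflexive; ∙-cong to +-cong;
              assoc to +-assoc; comm to +-comm; identityˡ to +-idˡ; identityʳ to +-idʳ;
              inverseˡ to -‿invˡ; inverseʳ to -‿invʳ)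
  open import Algebra.Properties.AbelianGroup abGroup public
    using (⁻¹-∙-comm; ε⁻¹≈ε) renaming (⁻¹-involutive to -‿involutive)
  open import Algebra.Properties.CommutativeSemigroup commutativeSemigroup public using (x∙yz≈y∙xz; interchange)

  open IsPartialOrder isPartialOrder public using (antisym)
    renaming (refl to ≤-refl; trans to ≤-trans; reflexive to ≤-reflexive;
              ≤-respˡ-≈ to ≤-respˡ; ≤-respʳ-≈ to ≤-respʳ)

  open import Algebra.Solver.CommutativeMonoid commutativeMonoid public using (solve; _⊜_; _⊕_)
  open import Relation.Binary.Reasoning.Setoid setoid

  ≤-resp : ∀ {a a' b b'} → a ≈ a' → b ≈ b' → a ≤ b → a' ≤ b'
  ≤-resp p q r = ≤-respˡ p (≤-respʳ q r)

  +-monoʳ : ∀ {a b} d → a ≤ b → (d + a) ≤ (d + b)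
  +-monoʳ {a} {b} d p = ≤-resp (+-comm a d) (+-comm b d) (+-mono d p)

  +-mono₂ : ∀ {a b d e} → a ≤ b → d ≤ e → (a + d) ≤ (b + e)
  +-mono₂ {a} {b} {d} {e} p q = ≤-trans (+-mono d p) (+-monoʳ b q)

  x+y-y≈x : ∀ x y → (x + y) - y ≈ x
  x+y-y≈x x y = ≈-trans (+-assoc x y (- y)) (≈-trans (+-cong ≈-refl (-‿invʳ y)) (+-idʳ x))

  x+[-x+y]≈y : ∀ x y → x + (- x + y) ≈ y
  x+[-x+y]≈y x y = ≈-trans (≈-sym (+-assoc x (- x) y)) (≈-trans (+-cong (-‿invʳ x) ≈-refl) (+-idˡ y))

  ≤-cancelʳ : ∀ {a b} d → (a + d) ≤ (b + d) → a ≤ b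
  ≤-cancelʳ {a} {b} d p = ≤-resp (x+y-y≈x a d) (x+y-y≈x b d) (+-mono (- d) p)

  -‿antimono : ∀ {a b} → a ≤ b → (- b) ≤ (- a)
  -‿antimono {a} {b} p = ≤-resp (x+[-x+y]≈y a (- b)) b-a-b≈-a (+-mono (- a + - b) p)
    where
    b-a-b≈-a : b + (- a + - b) ≈ - a
    b-a-b≈-a = ≈-trans (x∙yz≈y∙xz b (- a) (- b)) (≈-trans (+-cong ≈-refl (-‿invʳ b)) (+-idʳ (- a)))

  x-y≤0⇒x≤y : ∀ {a b} → (a - b) ≤ 0# → a ≤ b
  x-y≤0⇒x≤y {a} {b} p = ≤-resp (≈-trans (+-assoc a (- b) b) a+[-b+b]≈a) (+-idˡ b) (+-mono b p)
    where
    a+[-b+b]≈a : a + (- b + b) ≈ a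
    a+[-b+b]≈a = ≈-trans (+-cong ≈-refl (-‿invˡ b)) (+-idʳ a)

  x≤y⇒x-y≤0 : ∀ {a b} → a ≤ b → (a - b) ≤ 0#
  x≤y⇒x-y≤0 {a} {b} p = ≤-respʳ (-‿invʳ b) (+-mono (- b) p)

  ·-cong : ∀ n {a b} → a ≈ b → (n · a) ≈ (n · b)
  ·-cong zero p = ≈-refl
  ·-cong (suc n) p = +-cong p (·-cong n p)

  ·-congˡ : ∀ {m n a} → m ≡ n → (m · a) ≈ (n · a)
  ·-congˡ P.refl = ≈-refl

  +-· : ∀ m n a → ((m ℕ.+ n) · a) ≈ (m · a + n · a)
  +-· zero n a = ≈-sym (+-idˡ (n · a))
  +-· (suc m) n a = ≈-trans (+-cong ≈-refl (+-· m n a)) (≈-sym (+-assoc a (m · a) (n · a)))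

  *-· : ∀ m n a → ((m ℕ.* n) · a) ≈ (m · (n · a))
  *-· zero n a = ≈-refl
  *-· (suc m) n a = ≈-trans (+-· n (m ℕ.* n) a) (+-cong ≈-refl (*-· m n a))

  ·-comm : ∀ p q a → (p · (q · a)) ≈ (q · (p · a))
  ·-comm p q a = begin
    p · (q · a)      ≈⟨ *-· p q a ⟨
    (p ℕ.* q) · a    ≡⟨ P.cong (_· a) (ℕP.*-comm p q) ⟩
    (q ℕ.* p) · a    ≈⟨ *-· q p a ⟩
    q · (p · a)      ∎

  ·-distrib-+ : ∀ n a b → (n · (a + b)) ≈ (n · a + n · b)
  ·-distrib-+ zero a b = ≈-sym (+-idˡ 0#)
  ·-distrib-+ (suc n) a b = ≈-trans (+-cong ≈-refl (·-distrib-+ n a b)) (interchange a b (n · a) (n · b))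

  ·-zeroʳ : ∀ n → (n · 0#) ≈ 0#
  ·-zeroʳ zero = ≈-refl
  ·-zeroʳ (suc n) = ≈-trans (+-idˡ (n · 0#)) (·-zeroʳ n)

  ·-inverseʳ : ∀ n a → (n · a + n · (- a)) ≈ 0#
  ·-inverseʳ n a = ≈-trans (≈-sym (·-distrib-+ n a (- a))) (≈-trans (·-cong n (-‿invʳ a)) (·-zeroʳ n))

  ·-mono : ∀ n {a b} → a ≤ b → (n · a) ≤ (n · b)
  ·-mono zero p = ≤-refl
  ·-mono (suc n) p = +-mono₂ p (·-mono n p)

  fourier-motzkin : ∀ {X₁ Y₁ X₂ Y₂ d} p q → X₁ ≤ (Y₁ + p · d) → (X₂ + q · d) ≤ Y₂ →
                    (q · X₁ + p · X₂) ≤ (q · Y₁ + p · Y₂)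
  fourier-motzkin {X₁} {Y₁} {X₂} {Y₂} {d} p q h₁ h₂ =
    ≤-cancelʳ (p · (q · d)) (≤-resp lhs rhs (+-mono₂ (·-mono q h₁) (·-mono p h₂)))
    where
    lhs : (q · X₁ + p · (X₂ + q · d)) ≈ ((q · X₁ + p · X₂) + p · (q · d))
    lhs = ≈-trans (+-cong ≈-refl (·-distrib-+ p X₂ (q · d))) (≈-sym (+-assoc _ _ _))
    rhs : (q · (Y₁ + p · d) + p · Y₂) ≈ ((q · Y₁ + p · Y₂) + p · (q · d))
    rhs = begin
      q · (Y₁ + p · d) + p · Y₂          ≈⟨ +-cong (·-distrib-+ q Y₁ (p · d)) ≈-refl ⟩
      (q · Y₁ + q · (p · d)) + p · Y₂    ≈⟨ +-cong (+-cong ≈-refl (·-comm q p d)) ≈-refl ⟩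
      (q · Y₁ + p · (q · d)) + p · Y₂    ≈⟨ solve 3 (λ a b x → (a ⊕ b) ⊕ x ⊜ (a ⊕ x) ⊕ b) ≈-refl _ _ _ ⟩
      (q · Y₁ + p · Y₂) + p · (q · d)    ∎

  sumL : List Carrier → Carrier
  sumL [] = 0#
  sumL (x ∷ xs) = x + sumL xs

  sumL-++ : ∀ xs ys → sumL (xs ++ ys) ≈ (sumL xs + sumL ys)
  sumL-++ [] ys = ≈-sym (+-idˡ _)
  sumL-++ (x ∷ xs) ys = ≈-trans (+-cong ≈-refl (sumL-++ xs ys)) (≈-sym (+-assoc _ _ _))

  copies : ∀ {a} {A : Set a} → ℕ → List A → List A
  copies zero xs = []
  copies (suc n) xs = xs ++ copies n xs

  sumL-copies : ∀ n xs → sumL (copies n xs) ≈ (n · sumL xs)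
  sumL-copies zero xs = ≈-refl
  sumL-copies (suc n) xs = ≈-trans (sumL-++ xs (copies n xs)) (+-cong ≈-refl (sumL-copies n xs))


module LatticeGroupProperties {c ℓ₁ ℓ₂} (K : LatticeGroup c ℓ₁ ℓ₂) where
  open import Data.Nat using (ℕ; zero; suc)
  open import Data.Fin using (Fin; zero; suc)
  open import Data.List using ([]; _∷_; length)
  open import Data.List.Relation.Unary.All using (All; []; _∷_)
  open import Relation.Binary.Lattice.Structures using (IsLattice)

  open LatticeGroup K public using (_∧_; _∨_; ⋀; ⋁)
  open LatticeGroup K using (isLatticeGroup; orderedGroup)
  open OrderedGroupProperties orderedGroup public
  open IsLatticeGroup isLatticeGroup public using (+-distrib-∧; +-distrib-∨)
  open IsLattice (IsLatticeGroup.isLattice isLatticeGroup) public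
    using (x≤x∨y; y≤x∨y; ∨-least; x∧y≤x; x∧y≤y; ∧-greatest)
  open import Relation.Binary.Reasoning.Setoid setoid

  ∧-mono : ∀ {a b a' b'} → a ≤ a' → b ≤ b' → (a ∧ b) ≤ (a' ∧ b')
  ∧-mono p q = ∧-greatest (≤-trans (x∧y≤x _ _) p) (≤-trans (x∧y≤y _ _) q)

  ∨-mono : ∀ {a b a' b'} → a ≤ a' → b ≤ b' → (a ∨ b) ≤ (a' ∨ b')
  ∨-mono p q = ∨-least (≤-trans p (x≤x∨y _ _)) (≤-trans q (y≤x∨y _ _))

  ∧-cong : ∀ {a b a' b'} → a ≈ a' → b ≈ b' → (a ∧ b) ≈ (a' ∧ b')
  ∧-cong p q = antisym (∧-mono (≤-reflexive p) (≤-reflexive q))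
      (∧-mono (≤-reflexive (≈-sym p)) (≤-reflexive (≈-sym q)))

  ∨-cong : ∀ {a b a' b'} → a ≈ a' → b ≈ b' → (a ∨ b) ≈ (a' ∨ b')
  ∨-cong p q = antisym (∨-mono (≤-reflexive p) (≤-reflexive q))
      (∨-mono (≤-reflexive (≈-sym p)) (≤-reflexive (≈-sym q)))

  ∧-comm : ∀ a b → (a ∧ b) ≈ (b ∧ a)
  ∧-comm a b = antisym (∧-greatest (x∧y≤y _ _) (x∧y≤x _ _)) (∧-greatest (x∧y≤y _ _) (x∧y≤x _ _))

  +-distrib-∧ʳ : ∀ a b d → ((b ∧ d) + a) ≈ ((b + a) ∧ (d + a))
  +-distrib-∧ʳ a b d = ≈-trans (+-comm _ _) (≈-trans (+-distrib-∧ a b d) (∧-cong (+-comm a b) (+-comm a d)))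

  +-distrib-∨ʳ : ∀ a b d → ((b ∨ d) + a) ≈ ((b + a) ∨ (d + a))
  +-distrib-∨ʳ a b d = ≈-trans (+-comm _ _) (≈-trans (+-distrib-∨ a b d) (∨-cong (+-comm a b) (+-comm a d)))

  -[x∨y]≈-x∧-y : ∀ x y → (- (x ∨ y)) ≈ ((- x) ∧ (- y))
  -[x∨y]≈-x∧-y x y = antisym (∧-greatest (-‿antimono (x≤x∨y x y)) (-‿antimono (y≤x∨y x y)))
    (≤-respˡ (-‿involutive _) (-‿antimono (∨-least (≤-respˡ (-‿involutive x) (-‿antimono (x∧y≤x _ _)))
                                                   (≤-respˡ (-‿involutive y) (-‿antimono (x∧y≤y _ _))))))

  x+y-[x∨y]≈x∧y : ∀ x y → ((x + y) - (x ∨ y)) ≈ (x ∧ y)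
  x+y-[x∨y]≈x∧y x y = begin
    (x + y) - (x ∨ y)                  ≈⟨ +-cong ≈-refl (-[x∨y]≈-x∧-y x y) ⟩
    (x + y) + (- x ∧ - y)              ≈⟨ +-distrib-∧ (x + y) (- x) (- y) ⟩
    ((x + y) - x) ∧ ((x + y) - y)      ≈⟨ ∧-cong x+y-x≈y (x+y-y≈x x y) ⟩
    y ∧ x                              ≈⟨ ∧-comm y x ⟩
    x ∧ y                              ∎
    where
    x+y-x≈y : ((x + y) - x) ≈ y
    x+y-x≈y = ≈-trans (+-assoc x y (- x)) (≈-trans (+-cong ≈-refl (+-comm y (- x))) (x+[-x+y]≈y x y))

  -- The lattice of a lattice-ordered group is distributive: a ∧ t = a + t - (a ∨ t) turns meets into joins.
  ∧-distribˡ-∨-≤ : ∀ a b d → (a ∧ (b ∨ d)) ≤ ((a ∧ b) ∨ (a ∧ d))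
  ∧-distribˡ-∨-≤ a b d = ≤-respˡ (x+y-[x∨y]≈x∧y a (b ∨ d)) (≤-trans (≤-reflexive split) (∨-mono left right))
    where
    T : Carrier
    T = a ∨ (b ∨ d)
    split : ((a + (b ∨ d)) - T) ≈ (((a + b) - T) ∨ ((a + d) - T))
    split = ≈-trans (+-cong (+-distrib-∨ a b d) ≈-refl) (+-distrib-∨ʳ (- T) (a + b) (a + d))
    left : ((a + b) - T) ≤ (a ∧ b)
    left = ≤-respʳ (x+y-[x∨y]≈x∧y a b) (+-monoʳ (a + b) (-‿antimono (∨-mono ≤-refl (x≤x∨y b d))))
    right : ((a + d) - T) ≤ (a ∧ d)
    right = ≤-respʳ (x+y-[x∨y]≈x∧y a d) (+-monoʳ (a + d) (-‿antimono (∨-mono ≤-refl (y≤x∨y b d))))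

  joinMultiples : Carrier → ℕ → Carrier
  joinMultiples z zero = 0#
  joinMultiples z (suc k) = joinMultiples z k ∨ (suc k · z)

  x+joinMultiples≤ : ∀ z k → (z + joinMultiples z k) ≤ (joinMultiples z k ∨ (suc k · z))
  x+joinMultiples≤ z zero = y≤x∨y _ _
  x+joinMultiples≤ z (suc k) = ≤-trans (≤-reflexive (+-distrib-∨ z (joinMultiples z k) (suc k · z)))
     (∨-mono (x+joinMultiples≤ z k) ≤-refl)

  0≤joinMultiples : ∀ z k → 0# ≤ joinMultiples z k
  0≤joinMultiples z zero = ≤-refl
  0≤joinMultiples z (suc k) = ≤-trans (0≤joinMultiples z k) (x≤x∨y _ _)

  -- With W = 0 ∨ z ∨ … ∨ n·z, (suc n)·z ≤ 0 gives z + W ≤ W, and cancelling W leaves z ≤ 0.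
  suc·x≤0⇒x≤0 : ∀ n z → (suc n · z) ≤ 0# → z ≤ 0#
  suc·x≤0⇒x≤0 n z h = ≤-cancelʳ (joinMultiples z n) (≤-respʳ (≈-sym (+-idˡ _))
     (≤-trans (x+joinMultiples≤ z n) (∨-least ≤-refl (≤-trans h (0≤joinMultiples z n)))))

  ·-cancel-≤ : ∀ n {x y} → (suc n · x) ≤ (suc n · y) → x ≤ y
  ·-cancel-≤ n {x} {y} h = x-y≤0⇒x≤y (suc·x≤0⇒x≤0 n (x - y)
    (≤-resp (≈-sym (·-distrib-+ (suc n) x (- y))) (·-inverseʳ (suc n) y) (+-mono (suc n · (- y)) h)))

  sumL-lb : ∀ {m} xs → All (λ x → m ≤ x) xs → (length xs · m) ≤ sumL xs
  sumL-lb [] [] = ≤-refl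
  sumL-lb (x ∷ xs) (p ∷ ps) = +-mono₂ p (sumL-lb xs ps)

  sumL-ub : ∀ {M} xs → All (λ x → x ≤ M) xs → sumL xs ≤ (length xs · M)
  sumL-ub [] [] = ≤-refl
  sumL-ub (x ∷ xs) (p ∷ ps) = +-mono₂ p (sumL-ub xs ps)

  ⋀-lb : ∀ {k} (f : Fin (suc k) → Carrier) i → ⋀ f ≤ f i
  ⋀-lb {zero} f zero = ≤-refl
  ⋀-lb {suc k} f zero = x∧y≤x _ _
  ⋀-lb {suc k} f (suc i) = ≤-trans (x∧y≤y _ _) (⋀-lb (λ j → f (suc j)) i)

  ⋁-ub : ∀ {k} (f : Fin (suc k) → Carrier) i → f i ≤ ⋁ f
  ⋁-ub {zero} f zero = ≤-refl
  ⋁-ub {suc k} f zero = x≤x∨y _ _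
  ⋁-ub {suc k} f (suc i) = ≤-trans (⋁-ub (λ j → f (suc j)) i) (y≤x∨y _ _)

  ⋀-cong : ∀ {k} {f g : Fin (suc k) → Carrier} → (∀ i → f i ≈ g i) → ⋀ f ≈ ⋀ g
  ⋀-cong {zero} h = h zero
  ⋀-cong {suc k} h = ∧-cong (h zero) (⋀-cong (λ i → h (suc i)))

  ⋁-cong : ∀ {k} {f g : Fin (suc k) → Carrier} → (∀ i → f i ≈ g i) → ⋁ f ≈ ⋁ g
  ⋁-cong {zero} h = h zero
  ⋁-cong {suc k} h = ∨-cong (h zero) (⋁-cong (λ i → h (suc i)))


module Certificates {ℓ} (G : OrderedGroup ℓ ℓ ℓ) where
  open import Data.Nat as ℕ using (ℕ; zero; suc; _*_; s≤s; z≤n) renaming (_≤_ to _≤ℕ_)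
  import Data.Nat.Properties as ℕP
  open import Data.List using (List; []; _∷_; _++_; length)
  import Data.List.Properties as LP
  open import Data.List.Relation.Unary.All as All using (All; []; _∷_)
  import Data.List.Relation.Unary.All.Properties as AllP
  open import Data.List.Relation.Unary.Any using (here; there)
  open import Data.List.Membership.Propositional using (_∈_)
  open import Data.Product using (Σ; _×_; _,_)
  open import Relation.Binary.PropositionalEquality as P using (_≡_; refl)
  open import Data.Nat.Tactic.RingSolver using (solve-∀)
  open import Data.List.Relation.Binary.Subset.Propositional using (_⊆_)

  open OrderedGroupProperties G

  -- The multiset form of n₁a₁ + … + nₖaₖ ≤ m₁b₁ + … + mₗbₗ with Σn = Σm ≥ 1: each aᵢ is listed nᵢ times.
  record Certificate (A B : List Carrier) : Set ℓ where
    constructor certificate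
    field
      as bs : List Carrier
      asA : All (_∈ A) as
      bsB : All (_∈ B) bs
      len : length as ≡ length bs
      ne : 1 ≤ℕ length as
      le : sumL as ≤ sumL bs

  Certificate-mono : ∀ {A B A' B'} → A ⊆ A' → B ⊆ B' → Certificate A B → Certificate A' B'
  Certificate-mono f g (certificate as bs asA bsB len ne le) = certificate as bs (All.map f asA)
      (All.map g bsB) len ne le

  Certificate-single : ∀ {A B a b} → a ∈ A → b ∈ B → a ≤ b → Certificate A B
  Certificate-single {a = a} {b} p q r = certificate (a ∷ []) (b ∷ []) (p ∷ []) (q ∷ []) refl (s≤s z≤n)
      (+-mono 0# r)

  Certificate-pair : ∀ {A B a₁ a₂ b₁ b₂} → a₁ ∈ A → a₂ ∈ A → b₁ ∈ B → b₂ ∈ B → (a₁ + a₂) ≤ (b₁ + b₂)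
      → Certificate A B
  Certificate-pair {a₁ = a₁} {a₂} {b₁} {b₂} p₁ p₂ q₁ q₂ r =
    certificate (a₁ ∷ a₂ ∷ []) (b₁ ∷ b₂ ∷ []) (p₁ ∷ p₂ ∷ []) (q₁ ∷ q₂ ∷ []) refl (s≤s z≤n)
        (≤-resp (+-assoc _ _ _) (+-assoc _ _ _) (+-mono 0# r))

  record Translated (E F : List Carrier) (as bs : List Carrier) : Set ℓ where
    constructor translated
    field
      as' bs' es : List Carrier
      asE : All (_∈ E) as'
      bsF : All (_∈ F) bs'
      lena : length as' ≡ length as
      lenb : length bs' ≡ length bs
      suma : sumL as' ≈ (sumL as + sumL es)
      sumb : sumL bs' ≈ (sumL bs + sumL es)

  Translation : (A B E F : List Carrier) → Set ℓ
  Translation A B E F = ∀ {a b} → a ∈ A → b ∈ B →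
    Σ Carrier λ e → Σ Carrier λ a' → Σ Carrier λ b' → a' ∈ E × b' ∈ F × a' ≈ (a + e) × b' ≈ (b + e)

  translate : ∀ {A B E F} → Translation A B E F → ∀ as bs → All (_∈ A) as → All (_∈ B) bs
      → length as ≡ length bs → Translated E F as bs
  translate t [] [] [] [] eq = translated [] [] [] [] [] refl refl (≈-sym (+-idʳ 0#)) (≈-sym (+-idʳ 0#))
  translate t (a ∷ as) (b ∷ bs) (pa ∷ pas) (pb ∷ pbs) eq with t pa pb | translate t as bs pas pbs
      (ℕP.suc-injective eq)
  ... | e , a' , b' , pa' , pb' , ea , eb | translated as' bs' es asE bsF lena lenb suma sumb =
    translated (a' ∷ as') (b' ∷ bs') (e ∷ es) (pa' ∷ asE) (pb' ∷ bsF) (P.cong suc lena) (P.cong suc lenb)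
        (≈-trans (+-cong ea suma) (interchange a e (sumL as) (sumL es)))
        (≈-trans (+-cong eb sumb) (interchange b e (sumL bs) (sumL es)))

  Certificate-translate : ∀ {A B E F} → Certificate A B → Translation A B E F → Certificate E F
  Certificate-translate (certificate as bs asA bsB len ne le) t with translate t as bs asA bsB len
  ... | translated as' bs' es asE bsF lena lenb suma sumb =
    certificate as' bs' asE bsF (P.trans lena (P.trans len (P.sym lenb))) (P.subst (1 ≤ℕ_) (P.sym lena) ne)
        (≤-resp (≈-sym suma) (≈-sym sumb) (+-mono (sumL es) le))

  length-copies : ∀ {a} {A : Set a} n (xs : List A) → length (copies n xs) ≡ n * length xs
  length-copies zero xs = refl
  length-copies (suc n) xs = P.trans (LP.length-++ xs) (P.cong (length xs ℕ.+_) (length-copies n xs))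

  All-copies : ∀ {a} {A : Set a} {Q : A → Set ℓ} n {xs} → All Q xs → All Q (copies n xs)
  All-copies zero p = []
  All-copies (suc n) p = AllP.++⁺ p (All-copies n p)

  sumL-copies₂ : ∀ q xs p ys → sumL (copies q xs ++ copies p ys) ≈ (q · sumL xs + p · sumL ys)
  sumL-copies₂ q xs p ys = ≈-trans (sumL-++ (copies q xs) (copies p ys))
      (+-cong (sumL-copies q xs) (sumL-copies p ys))

  length-copies₂ : ∀ {a} {A : Set a} q (xs : List A) p ys
      → length (copies q xs ++ copies p ys) ≡ q * length xs ℕ.+ p * length ys
  length-copies₂ q xs p ys = P.trans (LP.length-++ (copies q xs))
      (P.cong₂ ℕ._+_ (length-copies q xs) (length-copies p ys))

  length-++-≥ : ∀ {a} {A : Set a} (xs ys : List A) → length xs ≤ℕ length (xs ++ ys)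
  length-++-≥ xs ys = ℕP.≤-trans (ℕP.m≤m+n (length xs) (length ys)) (ℕP.≤-reflexive (P.sym (LP.length-++ xs)))

  1≤length-copies : ∀ {a} {A : Set a} q (xs : List A) ys → 1 ≤ℕ length xs → 1 ≤ℕ length (copies (suc q) xs ++ ys)
  1≤length-copies q xs ys h = ℕP.≤-trans h
      (ℕP.≤-trans (length-++-≥ xs (copies q xs)) (length-++-≥ (xs ++ copies q xs) ys))

  separate : ∀ {c B} xs → All (_∈ c ∷ B) xs →
    Σ ℕ λ p → Σ (List Carrier) λ xs' → All (_∈ B) xs' × length xs ≡ p ℕ.+ length xs' × sumL xs ≈ (p · c + sumL xs')
  separate [] [] = 0 , [] , [] , refl , ≈-sym (+-idˡ 0#)
  separate (x ∷ xs) (here refl ∷ ps) with separate xs ps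
  ... | p , xs' , a , l , s = suc p , xs' , a , P.cong suc l , ≈-trans (+-cong ≈-refl s) (≈-sym (+-assoc _ _ _))
  separate {c} (x ∷ xs) (there q ∷ ps) with separate xs ps
  ... | p , xs' , a , l , s = p , x ∷ xs' , q ∷ a , P.trans (P.cong suc l) (P.sym (ℕP.+-suc p _)) ,
        ≈-trans (+-cong ≈-refl s) (x∙yz≈y∙xz x (p · c) (sumL xs'))

  private
    cut-length-identity : ∀ p q lb la → q * (p ℕ.+ lb) ℕ.+ p * la ≡ q * lb ℕ.+ p * (q ℕ.+ la)
    cut-length-identity = solve-∀

  -- Cut is admissible: scale the two certificates by the multiplicities of c in each, add, and c cancels.
  Certificate-cut : ∀ {A B c} → Certificate A (c ∷ B) → Certificate (c ∷ A) B → Certificate A B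
  Certificate-cut {A} {B} {c} (certificate as₁ bs₁ asA₁ bsB₁ len₁ ne₁ le₁)
      (certificate as₂ bs₂ asA₂ bsB₂ len₂ ne₂ le₂)
    with separate bs₁ bsB₁ | separate as₂ asA₂
  ... | zero , bs₁' , pb , lb , sb | q , as₂' , pa , la , sa =
    certificate as₁ bs₁' asA₁ pb (P.trans len₁ lb) ne₁ (≤-respʳ (≈-trans sb (+-idˡ _)) le₁)
  ... | suc p , bs₁' , pb , lb , sb | zero , as₂' , pa , la , sa =
    certificate as₂' bs₂ pa bsB₂ (P.trans (P.sym la) len₂) (P.subst (1 ≤ℕ_) la ne₂)
        (≤-respˡ (≈-trans sa (+-idˡ _)) le₂)
  ... | suc p , bs₁' , pb , lb , sb | suc q , as₂' , pa , la , sa =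
    certificate (copies (suc q) as₁ ++ copies (suc p) as₂') (copies (suc q) bs₁' ++ copies (suc p) bs₂)
        (AllP.++⁺ (All-copies (suc q) asA₁) (All-copies (suc p) pa))
        (AllP.++⁺ (All-copies (suc q) pb) (All-copies (suc p) bsB₂))
        length-combined (1≤length-copies q as₁ _ ne₁)
        (≤-resp (≈-sym (sumL-copies₂ (suc q) as₁ (suc p) as₂')) (≈-sym (sumL-copies₂ (suc q) bs₁' (suc p) bs₂))
          (fourier-motzkin (suc p) (suc q) h₁ h₂))
    where
    h₁ : sumL as₁ ≤ (sumL bs₁' + suc p · c)
    h₁ = ≤-respʳ (≈-trans sb (+-comm _ _)) le₁
    h₂ : (sumL as₂' + suc q · c) ≤ sumL bs₂
    h₂ = ≤-respˡ (≈-trans sa (+-comm _ _)) le₂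
    length-combined : length (copies (suc q) as₁ ++ copies (suc p) as₂') ≡ length (copies (suc q) bs₁' ++ copies (suc p) bs₂)
    length-combined = P.trans (length-copies₂ (suc q) as₁ (suc p) as₂')
            (P.trans (P.cong (λ z → suc q * z ℕ.+ suc p * length as₂') (P.trans len₁ lb))
            (P.trans (cut-length-identity (suc p) (suc q) (length bs₁') (length as₂'))
            (P.trans (P.cong (λ z → suc q * length bs₁' ℕ.+ suc p * z) (P.trans (P.sym la) len₂))
            (P.sym (length-copies₂ (suc q) bs₁' (suc p) bs₂)))))


module FinestRegularisation {ℓ} (G : OrderedGroup ℓ ℓ ℓ) where
  open import Data.Nat as ℕ using (ℕ; zero; suc; _*_; s≤s; z≤n) renaming (_≤_ to _≤ℕ_)
  import Data.Nat.Properties as ℕP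
  open import Data.Bool using (Bool; true; false)
  open import Data.Fin using (Fin; zero; suc)
  open import Data.List as List using (List; []; _∷_; _++_; length; map; tabulate; lookup; zipWith)
  import Data.List.Properties as LP
  open import Data.List.NonEmpty as L⁺ using (List⁺; _∷_; toList; [_]; _∷⁺_)
  open import Data.List.Relation.Unary.All as All using (All; []; _∷_)
  import Data.List.Relation.Unary.All.Properties as AllP
  open import Data.List.Relation.Unary.Any as Any using (Any; here; there)
  open import Data.List.Membership.Propositional using (_∈_; find)
  import Data.List.Membership.Propositional.Properties as MP
  open import Data.Product using (Σ; _×_; _,_; proj₁; proj₂)
  open import Data.Sum using (_⊎_; inj₁; inj₂)
  open import Relation.Binary.PropositionalEquality as P using (_≡_; refl)

  open OrderedGroupProperties G
  open Lorenzen G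
  open Certificates G

  ∈⇒∈≈ : ∀ {x xs} → x ∈ xs → Any (x ≈_) xs
  ∈⇒∈≈ = Any.map ≈-reflexive

  ∈≈⇒ : ∀ {x xs} → Any (x ≈_) xs → Σ Carrier λ y → y ∈ xs × x ≈ y
  ∈≈⇒ p = find p

  toList-concatMap : ∀ {X Y : Set ℓ} (f : X → List⁺ Y) (A : List⁺ X) →
    toList (L⁺.concatMap f A) ≡ List.concatMap (λ a → toList (f a)) (toList A)
  toList-concatMap f (a ∷ as) = P.cong (toList (f a) ++_) (P.cong List.concat (P.sym (LP.map-∘ as)))

  ⊖⁻ : ∀ {A B x} → x ∈ toList (A ⊖ B) → Σ Carrier λ a → Σ Carrier λ b → a ∈ toList A × b ∈ toList B × x ≡ (a - b)
  ⊖⁻ {A} {B} {x} p with find (MP.∈-concatMap⁻ (λ a → toList (L⁺.map (λ b → a - b) B)) {xs = toList A}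
                                (P.subst (x ∈_) (toList-concatMap (λ a → L⁺.map (λ b → a - b) B) A) p))
  ... | a , a∈ , q with MP.∈-map⁻ (λ b → a - b) {xs = toList B} q
  ... | b , b∈ , eq = a , b , a∈ , b∈ , eq

  ⊖⁺ : ∀ {A B a b} → a ∈ toList A → b ∈ toList B → (a - b) ∈ toList (A ⊖ B)
  ⊖⁺ {A} {B} {a} {b} p q = P.subst ((a - b) ∈_) (P.sym (toList-concatMap (λ a → L⁺.map (λ b → a - b) B) A))
    (MP.∈-concatMap⁺ (λ a → toList (L⁺.map (λ b → a - b) B)) {xs = toList A}
      (Any.map (λ { refl → MP.∈-map⁺ (λ b → a - b) q }) p))

  -- A derivation of C ▷ b in the finest system enlarged by 0 ▷ y (y ∈ ys) collapses to one inequality.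
  ClosureWitness : List Carrier → List⁺ Carrier → Carrier → Set ℓ
  ClosureWitness ys C b = Σ Carrier λ c → c ∈ toList C × Σ (List Carrier) λ zs → All (_∈ ys) zs × (c + sumL zs) ≤ b

  Closure⇒ClosureWitness : ∀ {ys C b} → Closure _▷s_ ys C b → ClosureWitness ys C b
  Closure⇒ClosureWitness (base p) with find p
  ... | a , a∈ , h = a , a∈ , [] , [] , ≤-respˡ (≈-sym (+-idʳ a)) h
  Closure⇒ClosureWitness (extra {y} y∈) =
    0# , here refl , y ∷ [] , y∈ ∷ [] , ≤-reflexive (≈-trans (+-idˡ _) (+-idʳ y))
  Closure⇒ClosureWitness (refl {a}) = a , here refl , [] , [] , ≤-reflexive (+-idʳ a)
  Closure⇒ClosureWitness (weaken p sub) with Closure⇒ClosureWitness p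
  ... | c , c∈ , zs , zs∈ , h with ∈≈⇒ (sub (∈⇒∈≈ c∈))
  ... | c' , c'∈ , c≈c' = c' , c'∈ , zs , zs∈ , ≤-respˡ (+-cong c≈c' ≈-refl) h
  Closure⇒ClosureWitness (cut p₁ p₂) with Closure⇒ClosureWitness p₁ | Closure⇒ClosureWitness p₂
  ... | c₁ , c₁∈ , zs₁ , zs₁∈ , h₁ | c₂ , here refl , zs₂ , zs₂∈ , h₂ =
    c₁ , c₁∈ , zs₁ ++ zs₂ , AllP.++⁺ zs₁∈ zs₂∈ ,
    ≤-trans (≤-respˡ (≈-trans (+-assoc _ _ _) (+-cong ≈-refl (≈-sym (sumL-++ zs₁ zs₂)))) (+-mono (sumL zs₂) h₁)) h₂
  ... | c₁ , c₁∈ , zs₁ , zs₁∈ , h₁ | c₂ , there c₂∈ , zs₂ , zs₂∈ , h₂ = c₂ , c₂∈ , zs₂ , zs₂∈ , h₂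
  Closure⇒ClosureWitness (order {a} h) = a , here refl , [] , [] , ≤-respˡ (≈-sym (+-idʳ a)) h
  Closure⇒ClosureWitness (shift x p) with Closure⇒ClosureWitness p
  ... | c , c∈ , zs , zs∈ , h =
    x + c , MP.∈-map⁺ (x +_) c∈ , zs , zs∈ , ≤-respˡ (≈-sym (+-assoc _ _ _)) (+-monoʳ x h)

  [x]⊆≈ : ∀ {x y} {A : List⁺ Carrier} → x ≈ y → y ∈ toList A → [ x ] ⊆≈ A
  [x]⊆≈ e y∈ (here p) = Any.map (λ { refl → ≈-trans p e }) y∈

  Closure-sumL : ∀ {▷ ys} zs → All (_∈ ys) zs → Closure ▷ ys [ 0# ] (sumL zs)
  Closure-sumL [] [] = refl
  Closure-sumL {▷} {ys} (z ∷ zs) (z∈ ∷ zs∈) =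
    cut (extra z∈) (weaken (shift z (Closure-sumL zs zs∈)) sub)
    where
    sub : L⁺.map (z +_) [ 0# ] ⊆≈ (z ∷⁺ [ 0# ])
    sub (here p) = here (≈-trans p (+-idʳ z))

  ClosureWitness⇒Closure : ∀ {▷ ys C b c zs} → c ∈ toList C → All (_∈ ys) zs → (c + sumL zs) ≤ b → Closure ▷ ys C b
  ClosureWitness⇒Closure {▷} {ys} {C} {b} {c} {zs} c∈ zs∈ h =
    weaken (cut (weaken (shift c (Closure-sumL zs zs∈)) ([x]⊆≈ (+-idʳ c) (here refl)))
                (weaken (order h) ([x]⊆≈ ≈-refl (here refl))))
           ([x]⊆≈ ≈-refl c∈)

  record PartialCertificate {m} (A B : List Carrier) (y : Fin m → Carrier) : Set ℓ where
    constructor partialCertificate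
    field
      as bs : List Carrier
      asA : All (_∈ A) as
      bsB : All (_∈ B) bs
      len : length as ≡ length bs
      ne : 1 ≤ℕ length as
      is : List (Fin m)
      le : (sumL as + sumL (map y is)) ≤ sumL bs

  tabulate-indices : ∀ {m} (y : Fin m → Carrier) zs → All (_∈ tabulate y) zs →
                     Σ (List (Fin m)) λ is → sumL zs ≈ sumL (map y is)
  tabulate-indices y [] [] = [] , ≈-refl
  tabulate-indices y (z ∷ zs) (z∈ ∷ zs∈) with MP.∈-tabulate⁻ z∈ | tabulate-indices y zs zs∈
  ... | i , refl | is , e = i ∷ is , +-cong ≈-refl e

  ClosureWitness⇒PartialCertificate : ∀ {m A B} (y : Fin m → Carrier)
      → ClosureWitness (tabulate y) (A ⊖ B) 0# → PartialCertificate (toList A) (toList B) y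
  ClosureWitness⇒PartialCertificate {A = A} {B} y (c , c∈ , zs , zs∈ , h)
    with ⊖⁻ {A} {B} c∈ | tabulate-indices y zs zs∈
  ... | a , b , a∈ , b∈ , refl | is , e =
    partialCertificate (a ∷ []) (b ∷ []) (a∈ ∷ []) (b∈ ∷ []) refl (s≤s z≤n) is
        (≤-resp rearrange (≈-trans (+-idˡ b) (≈-sym (+-idʳ b))) (+-mono b (≤-respˡ (+-cong ≈-refl e) h)))
    where
    S : Carrier
    S = sumL (map y is)
    rearrange : ((a - b) + S) + b ≈ ((a + 0#) + S)
    rearrange = ≈-trans (solve 4 (λ a nb s b → ((a ⊕ nb) ⊕ s) ⊕ b ⊜ (a ⊕ s) ⊕ (nb ⊕ b)) ≈-refl a (- b) S b)
         (≈-trans (+-cong ≈-refl (-‿invˡ b)) (≈-trans (+-idʳ (a + S)) (+-cong (≈-sym (+-idʳ a)) ≈-refl)))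

  split-zero : ∀ {k} → List (Fin (suc k)) → ℕ × List (Fin k)
  split-zero [] = 0 , []
  split-zero (zero ∷ is) = suc (proj₁ (split-zero is)) , proj₂ (split-zero is)
  split-zero (suc i ∷ is) = proj₁ (split-zero is) , i ∷ proj₂ (split-zero is)

  length-split-zero : ∀ {k} (is : List (Fin (suc k)))
      → length is ≡ proj₁ (split-zero is) ℕ.+ length (proj₂ (split-zero is))
  length-split-zero [] = refl
  length-split-zero (zero ∷ is) = P.cong suc (length-split-zero is)
  length-split-zero (suc i ∷ is) = P.trans (P.cong suc (length-split-zero is)) (P.sym (ℕP.+-suc _ _))

  sumL-split-zero : ∀ {k} (a : Fin (suc k) → Carrier) (is : List (Fin (suc k))) →
    sumL (map a is) ≈ (proj₁ (split-zero is) · a zero + sumL (map (λ i → a (suc i)) (proj₂ (split-zero is))))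
  sumL-split-zero a [] = ≈-sym (+-idˡ 0#)
  sumL-split-zero a (zero ∷ is) = ≈-trans (+-cong ≈-refl (sumL-split-zero a is)) (≈-sym (+-assoc _ _ _))
  sumL-split-zero a (suc i ∷ is) = ≈-trans (+-cong ≈-refl (sumL-split-zero a is)) (x∙yz≈y∙xz _ _ _)

  sumL-map-cong : ∀ {m} {f g : Fin m → Carrier} → (∀ i → f i ≈ g i) → ∀ is → sumL (map f is) ≈ sumL (map g is)
  sumL-map-cong p [] = ≈-refl
  sumL-map-cong p (i ∷ is) = +-cong (p i) (sumL-map-cong p is)

  map-copies : ∀ {a b} {X : Set a} {Y : Set b} (f : X → Y) n xs → map f (copies n xs) ≡ copies n (map f xs)
  map-copies f zero xs = refl
  map-copies f (suc n) xs = P.trans (LP.map-++ f xs (copies n xs)) (P.cong (map f xs ++_) (map-copies f n xs))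

  sumL-map-copies₂ : ∀ {m} (f : Fin m → Carrier) q xs p ys →
    sumL (map f (copies q xs ++ copies p ys)) ≈ (q · sumL (map f xs) + p · sumL (map f ys))
  sumL-map-copies₂ f q xs p ys = ≈-trans
      (≈-reflexive (P.cong sumL (P.trans (LP.map-++ f (copies q xs) (copies p ys))
      (P.cong₂ _++_ (map-copies f q xs) (map-copies f p ys))))) (sumL-copies₂ q (map f xs) p (map f ys))

  -- Fourier–Motzkin elimination of x₀ from a certificate using x₀ and one using −x₀.
  module _ {m} {A B : List Carrier} (x₀ : Carrier) (y' : Fin m → Carrier)
           (y₁ y₂ : Fin (suc m) → Carrier) (e₁ : y₁ zero ≈ x₀) (e₂ : y₂ zero ≈ (- x₀))
           (f₁ : ∀ i → y₁ (suc i) ≈ y' i) (f₂ : ∀ i → y₂ (suc i) ≈ y' i) where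

    eliminate-± : PartialCertificate A B y₁ → PartialCertificate A B y₂ → PartialCertificate A B y'
    eliminate-± (partialCertificate as₁ bs₁ asA₁ bsB₁ len₁ ne₁ is₁ le₁)
                (partialCertificate as₂ bs₂ asA₂ bsB₂ len₂ ne₂ is₂ le₂)
      with split-zero is₁ | sumL-split-zero y₁ is₁ | split-zero is₂ | sumL-split-zero y₂ is₂
    ... | zero , r₁ | s₁ | κ₂ , r₂ | s₂ =
      partialCertificate as₁ bs₁ asA₁ bsB₁ len₁ ne₁ r₁
          (≤-respˡ (+-cong ≈-refl (≈-trans s₁ (≈-trans (+-idˡ _) (sumL-map-cong f₁ r₁)))) le₁)
    ... | suc κ₁ , r₁ | s₁ | zero , r₂ | s₂ =
      partialCertificate as₂ bs₂ asA₂ bsB₂ len₂ ne₂ r₂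
          (≤-respˡ (+-cong ≈-refl (≈-trans s₂ (≈-trans (+-idˡ _) (sumL-map-cong f₂ r₂)))) le₂)
    ... | suc κ₁ , r₁ | s₁ | suc κ₂ , r₂ | s₂ =
      partialCertificate (copies k₁ as₂ ++ copies k₂ as₁) (copies k₁ bs₂ ++ copies k₂ bs₁)
          (AllP.++⁺ (All-copies k₁ asA₂) (All-copies k₂ asA₁))
          (AllP.++⁺ (All-copies k₁ bsB₂) (All-copies k₂ bsB₁))
          length-combined (1≤length-copies κ₁ as₂ _ ne₂) (copies k₁ r₂ ++ copies k₂ r₁)
          (≤-resp (≈-sym sum-combined) (≈-sym (sumL-copies₂ k₁ bs₂ k₂ bs₁)) (fourier-motzkin k₂ k₁ h₂ h₁))
      where
      k₁ k₂ : ℕ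
      k₁ = suc κ₁
      k₂ = suc κ₂
      S₁ S₂ : Carrier
      S₁ = sumL (map y' r₁)
      S₂ = sumL (map y' r₂)
      x₀-count₁ : sumL (map y₁ is₁) ≈ (k₁ · x₀ + S₁)
      x₀-count₁ = ≈-trans s₁ (+-cong (·-cong k₁ e₁) (sumL-map-cong f₁ r₁))
      x₀-count₂ : sumL (map y₂ is₂) ≈ (k₂ · (- x₀) + S₂)
      x₀-count₂ = ≈-trans s₂ (+-cong (·-cong k₂ e₂) (sumL-map-cong f₂ r₂))
      h₁ : ((sumL as₁ + S₁) + k₁ · x₀) ≤ sumL bs₁
      h₁ = ≤-respˡ (≈-trans (+-cong ≈-refl (≈-trans x₀-count₁ (+-comm _ _))) (≈-sym (+-assoc _ _ _))) le₁
      k₂·-x₀+k₂·x₀≈0 : (k₂ · (- x₀) + k₂ · x₀) ≈ 0#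
      k₂·-x₀+k₂·x₀≈0 = ≈-trans (+-comm _ _) (·-inverseʳ k₂ x₀)
      h₂ : (sumL as₂ + S₂) ≤ (sumL bs₂ + k₂ · x₀)
      h₂ = ≤-respˡ cancel-x₀ (+-mono (k₂ · x₀) (≤-respˡ (+-cong ≈-refl x₀-count₂) le₂))
        where
        cancel-x₀ : ((sumL as₂ + (k₂ · (- x₀) + S₂)) + k₂ · x₀) ≈ (sumL as₂ + S₂)
        cancel-x₀ = ≈-trans (solve 4 (λ a n s p → (a ⊕ (n ⊕ s)) ⊕ p ⊜ (a ⊕ s) ⊕ (n ⊕ p)) ≈-refl _ _ _ _)
                            (≈-trans (+-cong ≈-refl k₂·-x₀+k₂·x₀≈0) (+-idʳ _))
      sum-combined : (sumL (copies k₁ as₂ ++ copies k₂ as₁) + sumL (map y' (copies k₁ r₂ ++ copies k₂ r₁)))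
                     ≈ (k₁ · (sumL as₂ + S₂) + k₂ · (sumL as₁ + S₁))
      sum-combined = ≈-trans (+-cong (sumL-copies₂ k₁ as₂ k₂ as₁) (sumL-map-copies₂ y' k₁ r₂ k₂ r₁))
           (≈-trans (interchange _ _ _ _) (≈-sym (+-cong (·-distrib-+ k₁ _ _) (·-distrib-+ k₂ _ _))))
      length-combined : length (copies k₁ as₂ ++ copies k₂ as₁) ≡ length (copies k₁ bs₂ ++ copies k₂ bs₁)
      length-combined = P.trans (length-copies₂ k₁ as₂ k₂ as₁)
        (P.trans (P.cong₂ (λ u v → k₁ * u ℕ.+ k₂ * v) len₂ len₁) (P.sym (length-copies₂ k₁ bs₂ k₂ bs₁)))

  consSign : ∀ {m} → Bool → (Fin m → Bool) → Fin (suc m) → Bool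
  consSign b s zero = b
  consSign b s (suc i) = s i

  eliminate-all : ∀ m {A B} (x : Fin m → Carrier)
      → (∀ (s : Fin m → Bool) → PartialCertificate A B (λ i → signed (s i) (x i))) → Certificate A B
  eliminate-all zero x f with f (λ ())
  ... | partialCertificate as bs asA bsB len ne [] le = certificate as bs asA bsB len ne (≤-respˡ (+-idʳ _) le)
  ... | partialCertificate as bs asA bsB len ne (() ∷ _) le
  eliminate-all (suc m) x f = eliminate-all m (λ i → x (suc i)) λ s' →
    eliminate-± (x zero) (λ i → signed (s' i) (x (suc i))) (λ i → signed (consSign true s' i) (x i))
        (λ i → signed (consSign false s' i) (x i)) ≈-refl ≈-refl (λ i → ≈-refl) (λ i → ≈-refl)
         (f (consSign true s')) (f (consSign false s'))

  Regularisation⇒Certificate : ∀ {A B} → Regularisation _▷s_ A B → Certificate (toList A) (toList B)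
  Regularisation⇒Certificate {A} {B} (m , x , f) = eliminate-all m x λ (s : Fin m → Bool) →
      ClosureWitness⇒PartialCertificate {A = A} {B} (λ i → signed (s i) (x i)) (Closure⇒ClosureWitness (f s))


  All-zipWith-⊖ : ∀ {A B} as bs → All (_∈ toList A) as → All (_∈ toList B) bs
      → All (_∈ toList (A ⊖ B)) (zipWith _-_ as bs)
  All-zipWith-⊖ [] bs p q = []
  All-zipWith-⊖ (a ∷ as) [] p q = []
  All-zipWith-⊖ {A} {B} (a ∷ as) (b ∷ bs) (p ∷ ps) (q ∷ qs) = ⊖⁺ {A} {B} p q ∷ All-zipWith-⊖ {A} {B} as bs ps qs

  sumL-zipWith-⊖ : ∀ as bs → length as ≡ length bs → sumL (zipWith _-_ as bs) ≈ (sumL as - sumL bs)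
  sumL-zipWith-⊖ [] [] e = ≈-sym (≈-trans (+-idˡ _) ε⁻¹≈ε)
  sumL-zipWith-⊖ (a ∷ as) (b ∷ bs) e = ≈-trans (+-cong ≈-refl (sumL-zipWith-⊖ as bs (ℕP.suc-injective e)))
    (≈-trans (interchange _ _ _ _) (+-cong ≈-refl (⁻¹-∙-comm b (sumL bs))))

  some-false-or-all-true : ∀ {m} (s : Fin m → Bool) → (Σ (Fin m) λ i → s i ≡ false) ⊎ (∀ i → s i ≡ true)
  some-false-or-all-true {zero} s = inj₂ λ ()
  some-false-or-all-true {suc m} s with s zero in eq
  ... | false = inj₁ (zero , eq)
  ... | true with some-false-or-all-true (λ i → s (suc i))
  ...   | inj₁ (i , e) = inj₁ (suc i , e)
  ...   | inj₂ h = inj₂ λ { zero → eq ; (suc i) → h i }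

  -- Use the differences aᵢ − bᵢ as the xᵢ: a sign vector with a negative entry gives
  -- (aᵢ − bᵢ) − (aᵢ − bᵢ) ≤ 0 outright, and the all-positive one is the certificate itself.
  Certificate⇒Regularisation : ∀ {A B} → Certificate (toList A) (toList B) → Regularisation _▷s_ A B
  Certificate⇒Regularisation {A} {B} (certificate [] bs asA bsB len () le)
  Certificate⇒Regularisation {A} {B} (certificate (a ∷ as) [] asA bsB () ne le)
  Certificate⇒Regularisation {A} {B} (certificate (a ∷ as) (b ∷ bs) asA bsB len ne le) =
    length ds , lookup ds , closure-for-signs
    where
    ds : List Carrier
    ds = zipWith _-_ (a ∷ as) (b ∷ bs)
    dsAll : All (_∈ toList (A ⊖ B)) ds
    dsAll = All-zipWith-⊖ {A} {B} (a ∷ as) (b ∷ bs) asA bsB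
    closure-for-signs : ∀ s → Closure _▷s_ (tabulate (λ i → signed (s i) (lookup ds i))) (A ⊖ B) 0#
    closure-for-signs s with some-false-or-all-true s
    ... | inj₁ (i , e) = ClosureWitness⇒Closure (All.lookup dsAll (MP.∈-lookup i))
        (MP.∈-tabulate⁺ {f = λ j → signed (s j) (lookup ds j)} i ∷ []) h
      where
      h : (lookup ds i + (signed (s i) (lookup ds i) + 0#)) ≤ 0#
      h rewrite e = ≤-reflexive (≈-trans (+-cong ≈-refl (+-idʳ _)) (-‿invʳ _))
    ... | inj₂ allT = ClosureWitness⇒Closure (All.lookup dsAll (here refl)) rest∈ h
      where
      ysEq : tabulate (λ i → signed (s i) (lookup ds i)) ≡ ds
      ysEq = P.trans (LP.tabulate-cong (λ i → P.cong (λ z → signed z (lookup ds i)) (allT i)))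
          (LP.tabulate-lookup ds)
      rest∈ : All (_∈ tabulate (λ i → signed (s i) (lookup ds i))) (zipWith _-_ as bs)
      rest∈ = P.subst (λ ys → All (_∈ ys) (zipWith _-_ as bs)) (P.sym ysEq) (All.tabulate there)
      h : ((a - b) + sumL (zipWith _-_ as bs)) ≤ 0#
      h = ≤-respˡ (≈-sym (sumL-zipWith-⊖ (a ∷ as) (b ∷ bs) len)) (x≤y⇒x-y≤0 le)


module NormalForms {ℓ} (G : OrderedGroup ℓ ℓ ℓ) where
  open import Data.List using (List; []; _∷_; _++_)
  open import Data.List.NonEmpty as L⁺ using (List⁺; _∷_; toList; [_]; _⁺++⁺_)
  open import Data.List.Relation.Unary.All using ([]; _∷_)
  open import Data.List.Relation.Unary.Any as Any using (Any; here; there)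
  open import Data.List.Membership.Propositional using (_∈_; find)
  import Data.List.Membership.Propositional.Properties as MP
  open import Data.Product using (Σ; _×_; _,_)
  open import Data.Sum using (_⊎_; inj₁; inj₂)
  open import Relation.Binary.PropositionalEquality as P using (_≡_; refl)
  open import Data.List.Relation.Binary.Subset.Propositional using (_⊆_)
  open import Data.List.Relation.Binary.Subset.Propositional.Properties
    using (⊆-refl; ⊆-reflexive-↭; xs⊆xs++ys; xs⊆ys++xs)
  open import Data.List.Relation.Binary.Permutation.Propositional using (↭-trans)
  open import Data.List.Relation.Binary.Permutation.Propositional.Properties
    using (shifts) renaming (++-assoc to ↭-++-assoc)

  open OrderedGroupProperties G
  open Lorenzen G
  open Certificates G
  open FinestRegularisation G

  Clause : Set ℓ
  Clause = List⁺ Carrier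

  Clauses : Set ℓ
  Clauses = List⁺ Clause

  product : Clauses → Clauses → Clauses
  product X Y = L⁺.concatMap (λ C → L⁺.map (C ⁺++⁺_) Y) X

  DNF : Term → Clauses
  DNF (gen a) = [ [ a ] ]
  DNF (s ∧ₜ t) = product (DNF s) (DNF t)
  DNF (s ∨ₜ t) = DNF s ⁺++⁺ DNF t

  CNF : Term → Clauses
  CNF (gen a) = [ [ a ] ]
  CNF (s ∧ₜ t) = CNF s ⁺++⁺ CNF t
  CNF (s ∨ₜ t) = product (CNF s) (CNF t)

  _∈c_ : Clause → Clauses → Set ℓ
  C ∈c X = C ∈ toList X

  Certificate⁺ : Clause → Clause → Set ℓ
  Certificate⁺ C D = Certificate (toList C) (toList D)

  Certified : Term → Term → Set ℓ
  Certified s t = ∀ {C D} → C ∈c DNF s → D ∈c CNF t → Certificate⁺ C D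

  ++⁻ : ∀ {X Y : Clauses} {C} → C ∈c (X ⁺++⁺ Y) → C ∈c X ⊎ C ∈c Y
  ++⁻ {X} p = MP.∈-++⁻ (toList X) p

  ++ˡ : ∀ {X Y : Clauses} {C} → C ∈c X → C ∈c (X ⁺++⁺ Y)
  ++ˡ p = MP.∈-++⁺ˡ p

  ++ʳ : ∀ {X Y : Clauses} {C} → C ∈c Y → C ∈c (X ⁺++⁺ Y)
  ++ʳ {X} p = MP.∈-++⁺ʳ (toList X) p

  product⁻ : ∀ {X Y E} → E ∈c product X Y → Σ Clause λ C → Σ Clause λ D → C ∈c X × D ∈c Y × E ≡ (C ⁺++⁺ D)
  product⁻ {X} {Y} {E} p with find (MP.∈-concatMap⁻ (λ C → toList (L⁺.map (C ⁺++⁺_) Y)) {xs = toList X}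
                                (P.subst (E ∈_) (toList-concatMap (λ C → L⁺.map (C ⁺++⁺_) Y) X) p))
  ... | C , C∈ , q with MP.∈-map⁻ (C ⁺++⁺_) {xs = toList Y} q
  ... | D , D∈ , eq = C , D , C∈ , D∈ , eq

  product⁺ : ∀ {X Y C D} → C ∈c X → D ∈c Y → (C ⁺++⁺ D) ∈c product X Y
  product⁺ {X} {Y} {C} {D} p q = P.subst ((C ⁺++⁺ D) ∈_) (P.sym (toList-concatMap (λ C → L⁺.map (C ⁺++⁺_) Y) X))
    (MP.∈-concatMap⁺ (λ C → toList (L⁺.map (C ⁺++⁺_) Y)) {xs = toList X}
      (Any.map (λ { refl → MP.∈-map⁺ (C ⁺++⁺_) q }) p))

  inˡ : ∀ {x} {C D : Clause} → x ∈ toList C → x ∈ toList (C ⁺++⁺ D)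
  inˡ p = MP.∈-++⁺ˡ p

  inʳ : ∀ {x} {C D : Clause} → x ∈ toList D → x ∈ toList (C ⁺++⁺ D)
  inʳ {C = C} p = MP.∈-++⁺ʳ (toList C) p

  dnf∩cnf : ∀ t {C D} → C ∈c DNF t → D ∈c CNF t → Σ Carrier λ x → x ∈ toList C × x ∈ toList D
  dnf∩cnf (gen a) (here refl) (here refl) = a , here refl , here refl
  dnf∩cnf (s ∧ₜ t) {E} {D} p q with product⁻ {DNF s} {DNF t} p
  ... | C₁ , C₂ , C₁∈ , C₂∈ , refl with ++⁻ {CNF s} q
  ... | inj₁ D∈ = let x , a , b = dnf∩cnf s C₁∈ D∈ in x , inˡ {C = C₁} {C₂} a , b
  ... | inj₂ D∈ = let x , a , b = dnf∩cnf t C₂∈ D∈ in x , inʳ {C = C₁} {C₂} a , b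
  dnf∩cnf (s ∨ₜ t) {C} {E} p q with product⁻ {CNF s} {CNF t} q
  ... | D₁ , D₂ , D₁∈ , D₂∈ , refl with ++⁻ {DNF s} p
  ... | inj₁ C∈ = let x , a , b = dnf∩cnf s C∈ D₁∈ in x , a , inˡ {C = D₁} {D₂} b
  ... | inj₂ C∈ = let x , a , b = dnf∩cnf t C∈ D₂∈ in x , a , inʳ {C = D₁} {D₂} b

  Certificate-shared : ∀ {C D : Clause} {x} → x ∈ toList C → x ∈ toList D → Certificate⁺ C D
  Certificate-shared p q = Certificate-single p q ≤-refl

  ++-swap-⊆ : (xs ys zs : List Carrier) → ((xs ++ ys) ++ zs) ⊆ (ys ++ (xs ++ zs))
  ++-swap-⊆ xs ys zs = ⊆-reflexive-↭ (↭-trans (↭-++-assoc xs ys zs) (shifts xs ys {zs}))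

  -- Transitivity: a cut on a compound middle term splits along its normal forms into cuts on elements.
  Certified-cut-term : ∀ t {A B : List Carrier} → (∀ {D} → D ∈c CNF t → Certificate A (toList D ++ B)) →
         (∀ {C} → C ∈c DNF t → Certificate (toList C ++ A) B) → Certificate A B
  Certified-cut-term (gen c) h₁ h₂ = Certificate-cut (h₁ (here refl)) (h₂ (here refl))
  Certified-cut-term (s ∨ₜ t) {A} {B} h₁ h₂ =
    Certified-cut-term s {A} {B}
      (λ {D₁} D₁∈ → Certified-cut-term t {A} {toList D₁ ++ B}
         (λ {D₂} D₂∈ → Certificate-mono ⊆-refl (++-swap-⊆ (toList D₁) (toList D₂) B)
                                         (h₁ (product⁺ {CNF s} {CNF t} D₁∈ D₂∈)))
         (λ {C} C∈ → Certificate-mono ⊆-refl (xs⊆ys++xs _ (toList D₁)) (h₂ (++ʳ {DNF s} C∈))))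
      (λ C∈ → h₂ (++ˡ C∈))
  Certified-cut-term (s ∧ₜ t) {A} {B} h₁ h₂ =
    Certified-cut-term s {A} {B}
      (λ D₁∈ → h₁ (++ˡ D₁∈))
      (λ {C₁} C₁∈ → Certified-cut-term t {toList C₁ ++ A} {B}
         (λ {D₂} D₂∈ → Certificate-mono (xs⊆ys++xs _ (toList C₁)) ⊆-refl (h₁ (++ʳ {CNF s} D₂∈)))
         (λ {C₂} C₂∈ → Certificate-mono (++-swap-⊆ (toList C₁) (toList C₂) A) ⊆-refl
                                         (h₂ (product⁺ {DNF s} {DNF t} C₁∈ C₂∈))))

  Certified-trans : ∀ {s t u} → Certified s t → Certified t u → Certified s u
  Certified-trans {t = t} p q {C} {D} C∈ D∈ =
    Certified-cut-term t {toList C} {toList D}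
        (λ D'∈ → Certificate-mono ⊆-refl (xs⊆xs++ys _ _) (p C∈ D'∈))
        (λ C'∈ → Certificate-mono (xs⊆xs++ys _ _) ⊆-refl (q C'∈ D∈))

  Certified-refl : ∀ t → Certified t t
  Certified-refl t C∈ D∈ = let x , a , b = dnf∩cnf t C∈ D∈ in Certificate-shared a b

  dnf-⋀gen : ∀ a rest {C} → C ∈c DNF (⋀ₜ (L⁺.map gen (a ∷ rest))) → (a ∷ rest) ⊆ toList C
  dnf-⋀gen a [] (here refl) p = p
  dnf-⋀gen a (b ∷ rest) {E} q p with product⁻ {DNF (gen a)} {DNF (⋀ₜ (L⁺.map gen (b ∷ rest)))} q
  ... | .([ a ]) , C₂ , here refl , C₂∈ , refl with p
  ... | here e = here e
  ... | there p' = there (dnf-⋀gen b rest C₂∈ p')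

  cnf-⋁gen : ∀ a rest {D} → D ∈c CNF (⋁ₜ (L⁺.map gen (a ∷ rest))) → (a ∷ rest) ⊆ toList D
  cnf-⋁gen a [] (here refl) p = p
  cnf-⋁gen a (b ∷ rest) {E} q p with product⁻ {CNF (gen a)} {CNF (⋁ₜ (L⁺.map gen (b ∷ rest)))} q
  ... | .([ a ]) , D₂ , here refl , D₂∈ , refl with p
  ... | here e = here e
  ... | there p' = there (cnf-⋁gen b rest D₂∈ p')

  Below⇒Certified : ∀ {s t} → Below _▷s_ s t → Certified s t
  Below⇒Certified {s} ≼-refl = Certified-refl s
  Below⇒Certified (≼-trans {s} {t} {u} p q) = Certified-trans {s} {t} {u} (Below⇒Certified p) (Below⇒Certified q)
  Below⇒Certified (gen-≈ e) (here refl) (here refl) = Certificate-single (here refl) (here refl) (≤-reflexive e)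
  Below⇒Certified {s ∧ₜ t} ∧-lb₁ C∈ D∈ with product⁻ {DNF s} {DNF t} C∈
  ... | C₁ , C₂ , C₁∈ , C₂∈ , refl = let x , a , b = dnf∩cnf s C₁∈ D∈ in Certificate-shared (inˡ {C = C₁} {C₂} a) b
  Below⇒Certified {s ∧ₜ t} ∧-lb₂ C∈ D∈ with product⁻ {DNF s} {DNF t} C∈
  ... | C₁ , C₂ , C₁∈ , C₂∈ , refl = let x , a , b = dnf∩cnf t C₂∈ D∈ in Certificate-shared (inʳ {C = C₁} {C₂} a) b
  Below⇒Certified {u} {s ∧ₜ t} (∧-glb p q) C∈ D∈ with ++⁻ {CNF s} D∈
  ... | inj₁ D∈' = Below⇒Certified p C∈ D∈'
  ... | inj₂ D∈' = Below⇒Certified q C∈ D∈'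
  Below⇒Certified {s} {s ∨ₜ t} ∨-ub₁ C∈ D∈ with product⁻ {CNF s} {CNF t} D∈
  ... | D₁ , D₂ , D₁∈ , D₂∈ , refl = let x , a , b = dnf∩cnf s C∈ D₁∈ in Certificate-shared a (inˡ {C = D₁} {D₂} b)
  Below⇒Certified {t} {s ∨ₜ t} ∨-ub₂ C∈ D∈ with product⁻ {CNF s} {CNF t} D∈
  ... | D₁ , D₂ , D₁∈ , D₂∈ , refl = let x , a , b = dnf∩cnf t C∈ D₂∈ in Certificate-shared a (inʳ {C = D₁} {D₂} b)
  Below⇒Certified {s ∨ₜ t} (∨-lub p q) C∈ D∈ with ++⁻ {DNF s} C∈
  ... | inj₁ C∈' = Below⇒Certified p C∈' D∈
  ... | inj₂ C∈' = Below⇒Certified q C∈' D∈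
  Below⇒Certified {s ∧ₜ (t ∨ₜ u)} distrib C∈ D∈ with product⁻ {DNF s} {DNF t ⁺++⁺ DNF u} C∈
      | product⁻ {CNF s ⁺++⁺ CNF t} {CNF s ⁺++⁺ CNF u} D∈
  ... | Cs , C' , Cs∈ , C'∈ , refl | D₁ , D₂ , D₁∈ , D₂∈ , refl with ++⁻ {DNF t} C'∈
  ... | inj₁ Ct∈ with ++⁻ {CNF s} D₁∈
  ...   | inj₁ D∈' = let x , a , b = dnf∩cnf s Cs∈ D∈' in Certificate-shared (inˡ {C = Cs} {C'} a) (inˡ {C = D₁} {D₂} b)
  ...   | inj₂ D∈' = let x , a , b = dnf∩cnf t Ct∈ D∈' in Certificate-shared (inʳ {C = Cs} {C'} a) (inˡ {C = D₁} {D₂} b)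
  Below⇒Certified {s ∧ₜ (t ∨ₜ u)} distrib C∈ D∈
      | Cs , C' , Cs∈ , C'∈ , refl | D₁ , D₂ , D₁∈ , D₂∈ , refl | inj₂ Cu∈ with ++⁻ {CNF s} D₂∈
  ...   | inj₁ D∈' = let x , a , b = dnf∩cnf s Cs∈ D∈' in Certificate-shared (inˡ {C = Cs} {C'} a) (inʳ {C = D₁} {D₂} b)
  ...   | inj₂ D∈' = let x , a , b = dnf∩cnf u Cu∈ D∈' in Certificate-shared (inʳ {C = Cs} {C'} a) (inʳ {C = D₁} {D₂} b)
  Below⇒Certified (rel {a ∷ as} {b ∷ bs} r) C∈ D∈ = Certificate-mono (dnf-⋀gen a as C∈)
      (cnf-⋁gen b bs D∈) (Regularisation⇒Certificate r)

  infix 4 _≼_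
  _≼_ : Term → Term → Set ℓ
  _≼_ = Below _▷s_

  ∧-mono : ∀ {a b a' b'} → a ≼ a' → b ≼ b' → (a ∧ₜ b) ≼ (a' ∧ₜ b')
  ∧-mono p q = ∧-glb (≼-trans ∧-lb₁ p) (≼-trans ∧-lb₂ q)

  ∨-mono : ∀ {a b a' b'} → a ≼ a' → b ≼ b' → (a ∨ₜ b) ≼ (a' ∨ₜ b')
  ∨-mono p q = ∨-lub (≼-trans p ∨-ub₁) (≼-trans q ∨-ub₂)

  ∧-comm : ∀ {a b} → (a ∧ₜ b) ≼ (b ∧ₜ a)
  ∧-comm = ∧-glb ∧-lb₂ ∧-lb₁

  ∨-comm : ∀ {a b} → (a ∨ₜ b) ≼ (b ∨ₜ a)
  ∨-comm = ∨-lub ∨-ub₂ ∨-ub₁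

  ⋁ₜ-ub : ∀ (X : List⁺ Term) {y} → y ∈ toList X → y ≼ ⋁ₜ X
  ⋁ₜ-ub (x ∷ []) (here refl) = ≼-refl
  ⋁ₜ-ub (x ∷ z ∷ zs) (here refl) = ∨-ub₁
  ⋁ₜ-ub (x ∷ z ∷ zs) (there p) = ≼-trans (⋁ₜ-ub (z ∷ zs) p) ∨-ub₂

  ⋁ₜ-lub' : ∀ x (xs : List Term) {u} → (∀ {y} → y ∈ (x ∷ xs) → y ≼ u) → ⋁ₜ (x ∷ xs) ≼ u
  ⋁ₜ-lub' x [] h = h (here refl)
  ⋁ₜ-lub' x (z ∷ zs) h = ∨-lub (h (here refl)) (⋁ₜ-lub' z zs (λ p → h (there p)))

  ⋁ₜ-lub : ∀ (X : List⁺ Term) {u} → (∀ {y} → y ∈ toList X → y ≼ u) → ⋁ₜ X ≼ u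
  ⋁ₜ-lub (x ∷ xs) = ⋁ₜ-lub' x xs

  ⋀ₜ-lb : ∀ (X : List⁺ Term) {y} → y ∈ toList X → ⋀ₜ X ≼ y
  ⋀ₜ-lb (x ∷ []) (here refl) = ≼-refl
  ⋀ₜ-lb (x ∷ z ∷ zs) (here refl) = ∧-lb₁
  ⋀ₜ-lb (x ∷ z ∷ zs) (there p) = ≼-trans ∧-lb₂ (⋀ₜ-lb (z ∷ zs) p)

  ⋀ₜ-glb' : ∀ x (xs : List Term) {u} → (∀ {y} → y ∈ (x ∷ xs) → u ≼ y) → u ≼ ⋀ₜ (x ∷ xs)
  ⋀ₜ-glb' x [] h = h (here refl)
  ⋀ₜ-glb' x (z ∷ zs) h = ∧-glb (h (here refl)) (⋀ₜ-glb' z zs (λ p → h (there p)))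

  ⋀ₜ-glb : ∀ (X : List⁺ Term) {u} → (∀ {y} → y ∈ toList X → u ≼ y) → u ≼ ⋀ₜ X
  ⋀ₜ-glb (x ∷ xs) = ⋀ₜ-glb' x xs

  ∨-distribˡ-∧-≼ : ∀ {a b c} → ((a ∨ₜ b) ∧ₜ (a ∨ₜ c)) ≼ (a ∨ₜ (b ∧ₜ c))
  ∨-distribˡ-∧-≼ = ≼-trans distrib (∨-lub (≼-trans ∧-lb₂ ∨-ub₁)
    (≼-trans ∧-comm (≼-trans distrib (∨-lub (≼-trans ∧-lb₂ ∨-ub₁) (≼-trans ∧-comm ∨-ub₂)))))

  ∧-distrib-⋁′ : ∀ u x (xs : List Term) → (u ∧ₜ ⋁ₜ (x ∷ xs)) ≼ ⋁ₜ (L⁺.map (u ∧ₜ_) (x ∷ xs))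
  ∧-distrib-⋁′ u x [] = ≼-refl
  ∧-distrib-⋁′ u x (z ∷ zs) = ≼-trans distrib (∨-mono ≼-refl (∧-distrib-⋁′ u z zs))

  ∧-distrib-⋁ : ∀ u (X : List⁺ Term) → (u ∧ₜ ⋁ₜ X) ≼ ⋁ₜ (L⁺.map (u ∧ₜ_) X)
  ∧-distrib-⋁ u (x ∷ xs) = ∧-distrib-⋁′ u x xs

  ⋀-distrib-∨′ : ∀ u x (xs : List Term) → ⋀ₜ (L⁺.map (u ∨ₜ_) (x ∷ xs)) ≼ (u ∨ₜ ⋀ₜ (x ∷ xs))
  ⋀-distrib-∨′ u x [] = ≼-refl
  ⋀-distrib-∨′ u x (z ∷ zs) = ≼-trans (∧-mono ≼-refl (⋀-distrib-∨′ u z zs)) ∨-distribˡ-∧-≼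

  ⋀-distrib-∨ : ∀ u (X : List⁺ Term) → ⋀ₜ (L⁺.map (u ∨ₜ_) X) ≼ (u ∨ₜ ⋀ₜ X)
  ⋀-distrib-∨ u (x ∷ xs) = ⋀-distrib-∨′ u x xs

  map⁻ : ∀ {A B : Set ℓ} {f : A → B} (X : List⁺ A) {y} → y ∈ toList (L⁺.map f X) → Σ A λ x → x ∈ toList X × y ≡ f x
  map⁻ {f = f} X p = MP.∈-map⁻ f {xs = toList X} p

  map⁺ : ∀ {A B : Set ℓ} (f : A → B) (X : List⁺ A) {x} → x ∈ toList X → f x ∈ toList (L⁺.map f X)
  map⁺ f X p = MP.∈-map⁺ f p

  ⋁∧⋁-≼ : ∀ X Y T → (∀ {x y} → x ∈ toList X → y ∈ toList Y → (x ∧ₜ y) ≼ T) → (⋁ₜ X ∧ₜ ⋁ₜ Y) ≼ T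
  ⋁∧⋁-≼ X Y T h = ≼-trans (∧-distrib-⋁ (⋁ₜ X) Y) (⋁ₜ-lub (L⁺.map (⋁ₜ X ∧ₜ_) Y) λ z∈ →
    let y , y∈ , e = map⁻ Y z∈ in P.subst (_≼ T) (P.sym e)
      (≼-trans ∧-comm (≼-trans (∧-distrib-⋁ y X) (⋁ₜ-lub (L⁺.map (y ∧ₜ_) X) λ w∈ →
        let x , x∈ , e' = map⁻ X w∈ in P.subst (_≼ T) (P.sym e') (≼-trans ∧-comm (h x∈ y∈))))))

  ≼-⋀∨⋀ : ∀ X Y T → (∀ {x y} → x ∈ toList X → y ∈ toList Y → T ≼ (x ∨ₜ y)) → T ≼ (⋀ₜ X ∨ₜ ⋀ₜ Y)
  ≼-⋀∨⋀ X Y T h = ≼-trans (⋀ₜ-glb (L⁺.map (⋀ₜ X ∨ₜ_) Y) λ z∈ →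
    let y , y∈ , e = map⁻ Y z∈ in P.subst (T ≼_) (P.sym e)
      (≼-trans (⋀ₜ-glb (L⁺.map (y ∨ₜ_) X) λ w∈ →
        let x , x∈ , e' = map⁻ X w∈ in P.subst (T ≼_) (P.sym e') (≼-trans (h x∈ y∈) ∨-comm))
        (≼-trans (⋀-distrib-∨ y X) ∨-comm))) (⋀-distrib-∨ (⋀ₜ X) Y)

  conj : Clause → Term
  conj C = ⋀ₜ (L⁺.map gen C)

  disj : Clause → Term
  disj D = ⋁ₜ (L⁺.map gen D)

  conj-lb : ∀ (C : Clause) {x} → x ∈ toList C → conj C ≼ gen x
  conj-lb C p = ⋀ₜ-lb (L⁺.map gen C) (map⁺ gen C p)

  disj-ub : ∀ (D : Clause) {x} → x ∈ toList D → gen x ≼ disj D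
  disj-ub D p = ⋁ₜ-ub (L⁺.map gen D) (map⁺ gen D p)

  conj++ : ∀ (C₁ C₂ : Clause) → (conj C₁ ∧ₜ conj C₂) ≼ conj (C₁ ⁺++⁺ C₂)
  conj++ C₁ C₂ = ⋀ₜ-glb (L⁺.map gen (C₁ ⁺++⁺ C₂)) λ z∈ →
    let x , x∈ , e = map⁻ (C₁ ⁺++⁺ C₂) z∈ in P.subst (_ ≼_) (P.sym e) (h x∈)
    where
    h : ∀ {x} → x ∈ toList (C₁ ⁺++⁺ C₂) → (conj C₁ ∧ₜ conj C₂) ≼ gen x
    h p with MP.∈-++⁻ (toList C₁) p
    ... | inj₁ q = ≼-trans ∧-lb₁ (conj-lb C₁ q)
    ... | inj₂ q = ≼-trans ∧-lb₂ (conj-lb C₂ q)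

  disj++ : ∀ (D₁ D₂ : Clause) → disj (D₁ ⁺++⁺ D₂) ≼ (disj D₁ ∨ₜ disj D₂)
  disj++ D₁ D₂ = ⋁ₜ-lub (L⁺.map gen (D₁ ⁺++⁺ D₂)) λ z∈ →
    let x , x∈ , e = map⁻ (D₁ ⁺++⁺ D₂) z∈ in P.subst (_≼ _) (P.sym e) (h x∈)
    where
    h : ∀ {x} → x ∈ toList (D₁ ⁺++⁺ D₂) → gen x ≼ (disj D₁ ∨ₜ disj D₂)
    h p with MP.∈-++⁻ (toList D₁) p
    ... | inj₁ q = ≼-trans (disj-ub D₁ q) ∨-ub₁
    ... | inj₂ q = ≼-trans (disj-ub D₂ q) ∨-ub₂

  ⋁-sub : ∀ (X Y : Clauses) → (∀ {C} → C ∈c X → C ∈c Y) → ⋁ₜ (L⁺.map conj X) ≼ ⋁ₜ (L⁺.map conj Y)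
  ⋁-sub X Y f = ⋁ₜ-lub (L⁺.map conj X) λ z∈ →
    let C , C∈ , e = map⁻ X z∈ in P.subst (_≼ _) (P.sym e) (⋁ₜ-ub (L⁺.map conj Y) (map⁺ conj Y (f C∈)))

  ⋀-sub : ∀ (X Y : Clauses) → (∀ {C} → C ∈c X → C ∈c Y) → ⋀ₜ (L⁺.map disj Y) ≼ ⋀ₜ (L⁺.map disj X)
  ⋀-sub X Y f = ⋀ₜ-glb (L⁺.map disj X) λ z∈ →
    let C , C∈ , e = map⁻ X z∈ in P.subst (_ ≼_) (P.sym e) (⋀ₜ-lb (L⁺.map disj Y) (map⁺ disj Y (f C∈)))

  ≼-dnf : ∀ s → s ≼ ⋁ₜ (L⁺.map conj (DNF s))
  ≼-dnf (gen a) = ≼-refl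
  ≼-dnf (s ∨ₜ t) = ∨-lub (≼-trans (≼-dnf s) (⋁-sub (DNF s) (DNF s ⁺++⁺ DNF t) ++ˡ))
                       (≼-trans (≼-dnf t) (⋁-sub (DNF t) (DNF s ⁺++⁺ DNF t) (++ʳ {DNF s})))
  ≼-dnf (s ∧ₜ t) = ≼-trans (∧-mono (≼-dnf s) (≼-dnf t)) (⋁∧⋁-≼ _ _ _ λ x∈ y∈ →
    let C₁ , C₁∈ , e₁ = map⁻ (DNF s) x∈ ; C₂ , C₂∈ , e₂ = map⁻ (DNF t) y∈ in
    P.subst₂ (λ u v → (u ∧ₜ v) ≼ _) (P.sym e₁) (P.sym e₂)
      (≼-trans (conj++ C₁ C₂)
               (⋁ₜ-ub (L⁺.map conj (product (DNF s) (DNF t)))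
                      (map⁺ conj (product (DNF s) (DNF t)) (product⁺ {DNF s} {DNF t} C₁∈ C₂∈)))))

  cnf-≼ : ∀ t → ⋀ₜ (L⁺.map disj (CNF t)) ≼ t
  cnf-≼ (gen a) = ≼-refl
  cnf-≼ (s ∧ₜ t) = ∧-glb (≼-trans (⋀-sub (CNF s) (CNF s ⁺++⁺ CNF t) ++ˡ) (cnf-≼ s))
                       (≼-trans (⋀-sub (CNF t) (CNF s ⁺++⁺ CNF t) (++ʳ {CNF s})) (cnf-≼ t))
  cnf-≼ (s ∨ₜ t) = ≼-trans (≼-⋀∨⋀ _ _ _ λ x∈ y∈ →
    let D₁ , D₁∈ , e₁ = map⁻ (CNF s) x∈ ; D₂ , D₂∈ , e₂ = map⁻ (CNF t) y∈ in
    P.subst₂ (λ u v → _ ≼ (u ∨ₜ v)) (P.sym e₁) (P.sym e₂)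
      (≼-trans (⋀ₜ-lb (L⁺.map disj (product (CNF s) (CNF t)))
                      (map⁺ disj (product (CNF s) (CNF t)) (product⁺ {CNF s} {CNF t} D₁∈ D₂∈)))
               (disj++ D₁ D₂)))
    (∨-mono (cnf-≼ s) (cnf-≼ t))

  Certificate⇒≼ : ∀ {C D : Clause} → Certificate⁺ C D → conj C ≼ disj D
  Certificate⇒≼ {C} {D} r = rel {A = C} {B = D} (Certificate⇒Regularisation {C} {D} r)

  Certified⇒Below : ∀ {s t} → Certified s t → s ≼ t
  Certified⇒Below {s} {t} h = ≼-trans (≼-dnf s) (≼-trans dnf≼cnf (cnf-≼ t))
    where
    dnf≼cnf : ⋁ₜ (L⁺.map conj (DNF s)) ≼ ⋀ₜ (L⁺.map disj (CNF t))
    dnf≼cnf = ⋁ₜ-lub (L⁺.map conj (DNF s)) λ z∈ → let C , C∈ , e = map⁻ (DNF s) z∈ in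
          P.subst (_≼ _) (P.sym e) (⋀ₜ-glb (L⁺.map disj (CNF t)) λ w∈ → let D , D∈ , e' = map⁻ (CNF t) w∈ in
          P.subst (_ ≼_) (P.sym e') (Certificate⇒≼ (h C∈ D∈)))


module TermGroup {ℓ} (G : OrderedGroup ℓ ℓ ℓ) where
  open import Data.List.NonEmpty using (toList; [_]; _⁺++⁺_)
  open import Data.List.Relation.Unary.Any using (here)
  open import Data.List.Membership.Propositional using (_∈_)
  import Data.List.Membership.Propositional.Properties as MP
  open import Data.Product using (Σ; _×_; _,_; proj₁; proj₂)
  open import Data.Sum using (_⊎_; inj₁; inj₂)
  open import Relation.Binary.PropositionalEquality as P using (_≡_; refl)
  open import Relation.Binary.Structures using (IsEquivalence)
  open import Relation.Binary.Bundles using (Setoid)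

  open OrderedGroupProperties G
  open Lorenzen G
  open Certificates G
  open NormalForms G

  shiftₜ : Carrier → Term → Term
  shiftₜ a (gen b) = gen (a + b)
  shiftₜ a (s ∧ₜ t) = shiftₜ a s ∧ₜ shiftₜ a t
  shiftₜ a (s ∨ₜ t) = shiftₜ a s ∨ₜ shiftₜ a t

  infixl 6 _⊕ₜ_
  _⊕ₜ_ : Term → Term → Term
  gen a ⊕ₜ u = shiftₜ a u
  (s ∧ₜ t) ⊕ₜ u = (s ⊕ₜ u) ∧ₜ (t ⊕ₜ u)
  (s ∨ₜ t) ⊕ₜ u = (s ⊕ₜ u) ∨ₜ (t ⊕ₜ u)

  negₜ : Term → Term
  negₜ (gen a) = gen (- a)
  negₜ (s ∧ₜ t) = negₜ s ∨ₜ negₜ t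
  negₜ (s ∨ₜ t) = negₜ s ∧ₜ negₜ t

  ShiftedDNF : Carrier → Term → Clause → Set ℓ
  ShiftedDNF a u E = Σ Clause λ C' → C' ∈c DNF u × (∀ {c'} → c' ∈ toList C' → (a + c') ∈ toList E)

  ShiftedCNF : Carrier → Term → Clause → Set ℓ
  ShiftedCNF a u E = Σ Clause λ C' → C' ∈c CNF u × (∀ {c'} → c' ∈ toList C' → (a + c') ∈ toList E)

  split++ : ∀ {C₁ C₂ : Clause} {x} → x ∈ toList (C₁ ⁺++⁺ C₂) → x ∈ toList C₁ ⊎ x ∈ toList C₂
  split++ {C₁} p = MP.∈-++⁻ (toList C₁) p

  ShiftedDNF-mono : ∀ {c} u {E E'} → (∀ {x} → x ∈ toList E → x ∈ toList E') → ShiftedDNF c u E → ShiftedDNF c u E'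
  ShiftedDNF-mono u f (C , C∈ , g) = C , C∈ , λ p → f (g p)

  ShiftedCNF-mono : ∀ {c} u {E E'} → (∀ {x} → x ∈ toList E → x ∈ toList E') → ShiftedCNF c u E → ShiftedCNF c u E'
  ShiftedCNF-mono u f (C , C∈ , g) = C , C∈ , λ p → f (g p)

  ShiftedDNF-∧ : ∀ a u₁ u₂ {E₁ E₂} → ShiftedDNF a u₁ E₁ → ShiftedDNF a u₂ E₂ → ShiftedDNF a (u₁ ∧ₜ u₂) (E₁ ⁺++⁺ E₂)
  ShiftedDNF-∧ a u₁ u₂ {E₁} {E₂} (C₁ , C₁∈ , f₁) (C₂ , C₂∈ , f₂) =
    C₁ ⁺++⁺ C₂ , product⁺ {DNF u₁} {DNF u₂} C₁∈ C₂∈ , λ p → g (split++ {C₁} {C₂} p)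
    where
    g : ∀ {c'} → c' ∈ toList C₁ ⊎ c' ∈ toList C₂ → (a + c') ∈ toList (E₁ ⁺++⁺ E₂)
    g (inj₁ q) = inˡ {C = E₁} {E₂} (f₁ q)
    g (inj₂ q) = inʳ {C = E₁} {E₂} (f₂ q)

  ShiftedCNF-∨ : ∀ a u₁ u₂ {E₁ E₂} → ShiftedCNF a u₁ E₁ → ShiftedCNF a u₂ E₂ → ShiftedCNF a (u₁ ∨ₜ u₂) (E₁ ⁺++⁺ E₂)
  ShiftedCNF-∨ a u₁ u₂ {E₁} {E₂} (C₁ , C₁∈ , f₁) (C₂ , C₂∈ , f₂) =
    C₁ ⁺++⁺ C₂ , product⁺ {CNF u₁} {CNF u₂} C₁∈ C₂∈ , λ p → g (split++ {C₁} {C₂} p)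
    where
    g : ∀ {c'} → c' ∈ toList C₁ ⊎ c' ∈ toList C₂ → (a + c') ∈ toList (E₁ ⁺++⁺ E₂)
    g (inj₁ q) = inˡ {C = E₁} {E₂} (f₁ q)
    g (inj₂ q) = inʳ {C = E₁} {E₂} (f₂ q)

  dnf-shift : ∀ a u {E} → E ∈c DNF (shiftₜ a u) → ShiftedDNF a u E
  dnf-shift a (gen b) (here refl) = [ b ] , here refl , λ { (here refl) → here refl }
  dnf-shift a (u₁ ∧ₜ u₂) E∈ =
    let E₁ , E₂ , E₁∈ , E₂∈ , eq = product⁻ {DNF (shiftₜ a u₁)} {DNF (shiftₜ a u₂)} E∈ in
    ShiftedDNF-mono (u₁ ∧ₜ u₂) (P.subst (λ Z → _ ∈ toList Z) (P.sym eq))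
        (ShiftedDNF-∧ a u₁ u₂ (dnf-shift a u₁ E₁∈) (dnf-shift a u₂ E₂∈))
  dnf-shift a (u₁ ∨ₜ u₂) E∈ with ++⁻ {DNF (shiftₜ a u₁)} E∈
  ... | inj₁ q = let C , C∈ , f = dnf-shift a u₁ q in C , ++ˡ C∈ , f
  ... | inj₂ q = let C , C∈ , f = dnf-shift a u₂ q in C , ++ʳ {DNF u₁} C∈ , f

  cnf-shift : ∀ a u {E} → E ∈c CNF (shiftₜ a u) → ShiftedCNF a u E
  cnf-shift a (gen b) (here refl) = [ b ] , here refl , λ { (here refl) → here refl }
  cnf-shift a (u₁ ∨ₜ u₂) E∈ =
    let E₁ , E₂ , E₁∈ , E₂∈ , eq = product⁻ {CNF (shiftₜ a u₁)} {CNF (shiftₜ a u₂)} E∈ in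
    ShiftedCNF-mono (u₁ ∨ₜ u₂) (P.subst (λ Z → _ ∈ toList Z) (P.sym eq))
        (ShiftedCNF-∨ a u₁ u₂ (cnf-shift a u₁ E₁∈) (cnf-shift a u₂ E₂∈))
  cnf-shift a (u₁ ∧ₜ u₂) E∈ with ++⁻ {CNF (shiftₜ a u₁)} E∈
  ... | inj₁ q = let C , C∈ , f = cnf-shift a u₁ q in C , ++ˡ C∈ , f
  ... | inj₂ q = let C , C∈ , f = cnf-shift a u₂ q in C , ++ʳ {CNF u₁} C∈ , f

  SumDNF : Term → Term → Clause → Set ℓ
  SumDNF s u E = Σ Clause λ C → C ∈c DNF s × (∀ {c} → c ∈ toList C → ShiftedDNF c u E)

  SumCNF : Term → Term → Clause → Set ℓ
  SumCNF s u E = Σ Clause λ C → C ∈c CNF s × (∀ {c} → c ∈ toList C → ShiftedCNF c u E)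

  SumDNF-∧ : ∀ s₁ s₂ u {E₁ E₂} → SumDNF s₁ u E₁ → SumDNF s₂ u E₂ → SumDNF (s₁ ∧ₜ s₂) u (E₁ ⁺++⁺ E₂)
  SumDNF-∧ s₁ s₂ u {E₁} {E₂} (C₁ , C₁∈ , f₁) (C₂ , C₂∈ , f₂) =
    C₁ ⁺++⁺ C₂ , product⁺ {DNF s₁} {DNF s₂} C₁∈ C₂∈ , λ p → g (split++ {C₁} {C₂} p)
    where
    g : ∀ {c} → c ∈ toList C₁ ⊎ c ∈ toList C₂ → ShiftedDNF c u (E₁ ⁺++⁺ E₂)
    g (inj₁ q) = ShiftedDNF-mono u (inˡ {C = E₁} {E₂}) (f₁ q)
    g (inj₂ q) = ShiftedDNF-mono u (inʳ {C = E₁} {E₂}) (f₂ q)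

  SumCNF-∨ : ∀ s₁ s₂ u {E₁ E₂} → SumCNF s₁ u E₁ → SumCNF s₂ u E₂ → SumCNF (s₁ ∨ₜ s₂) u (E₁ ⁺++⁺ E₂)
  SumCNF-∨ s₁ s₂ u {E₁} {E₂} (C₁ , C₁∈ , f₁) (C₂ , C₂∈ , f₂) =
    C₁ ⁺++⁺ C₂ , product⁺ {CNF s₁} {CNF s₂} C₁∈ C₂∈ , λ p → g (split++ {C₁} {C₂} p)
    where
    g : ∀ {c} → c ∈ toList C₁ ⊎ c ∈ toList C₂ → ShiftedCNF c u (E₁ ⁺++⁺ E₂)
    g (inj₁ q) = ShiftedCNF-mono u (inˡ {C = E₁} {E₂}) (f₁ q)
    g (inj₂ q) = ShiftedCNF-mono u (inʳ {C = E₁} {E₂}) (f₂ q)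

  SumDNF-subst : ∀ {s u E E'} → E ≡ E' → SumDNF s u E → SumDNF s u E'
  SumDNF-subst refl p = p

  SumCNF-subst : ∀ {s u E E'} → E ≡ E' → SumCNF s u E → SumCNF s u E'
  SumCNF-subst refl p = p

  dnf-⊕ : ∀ s u {E} → E ∈c DNF (s ⊕ₜ u) → SumDNF s u E
  dnf-⊕ (gen a) u E∈ = [ a ] , here refl , λ { (here refl) → dnf-shift a u E∈ }
  dnf-⊕ (s₁ ∧ₜ s₂) u E∈ =
    let E₁ , E₂ , E₁∈ , E₂∈ , eq = product⁻ {DNF (s₁ ⊕ₜ u)} {DNF (s₂ ⊕ₜ u)} E∈ in
    SumDNF-subst {s₁ ∧ₜ s₂} {u} (P.sym eq) (SumDNF-∧ s₁ s₂ u (dnf-⊕ s₁ u E₁∈) (dnf-⊕ s₂ u E₂∈))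
  dnf-⊕ (s₁ ∨ₜ s₂) u E∈ with ++⁻ {DNF (s₁ ⊕ₜ u)} E∈
  ... | inj₁ q = let C , C∈ , f = dnf-⊕ s₁ u q in C , ++ˡ C∈ , f
  ... | inj₂ q = let C , C∈ , f = dnf-⊕ s₂ u q in C , ++ʳ {DNF s₁} C∈ , f

  cnf-⊕ : ∀ s u {E} → E ∈c CNF (s ⊕ₜ u) → SumCNF s u E
  cnf-⊕ (gen a) u E∈ = [ a ] , here refl , λ { (here refl) → cnf-shift a u E∈ }
  cnf-⊕ (s₁ ∨ₜ s₂) u E∈ =
    let E₁ , E₂ , E₁∈ , E₂∈ , eq = product⁻ {CNF (s₁ ⊕ₜ u)} {CNF (s₂ ⊕ₜ u)} E∈ in
    SumCNF-subst {s₁ ∨ₜ s₂} {u} (P.sym eq) (SumCNF-∨ s₁ s₂ u (cnf-⊕ s₁ u E₁∈) (cnf-⊕ s₂ u E₂∈))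
  cnf-⊕ (s₁ ∧ₜ s₂) u E∈ with ++⁻ {CNF (s₁ ⊕ₜ u)} E∈
  ... | inj₁ q = let C , C∈ , f = cnf-⊕ s₁ u q in C , ++ˡ C∈ , f
  ... | inj₂ q = let C , C∈ , f = cnf-⊕ s₂ u q in C , ++ʳ {CNF s₁} C∈ , f

  Certified-⊕-monoˡ : ∀ s t u → Certified s t → Certified (s ⊕ₜ u) (t ⊕ₜ u)
  Certified-⊕-monoˡ s t u h {E} {F} E∈ F∈ =
    let C , C∈ , fC = dnf-⊕ s u E∈ ; D , D∈ , fD = cnf-⊕ t u F∈ in
    Certificate-translate (h C∈ D∈) λ a∈ b∈ →
      let C' , C'∈ , g = fC a∈ ; D' , D'∈ , g' = fD b∈ ; e , e∈C , e∈D = dnf∩cnf u C'∈ D'∈ in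
      e , _ , _ , g e∈C , g' e∈D , ≈-refl , ≈-refl

  Certified-⊕-monoʳ : ∀ s u v → Certified u v → Certified (s ⊕ₜ u) (s ⊕ₜ v)
  Certified-⊕-monoʳ s u v h {E} {F} E∈ F∈ =
    let C , C∈ , fC = dnf-⊕ s u E∈ ; D , D∈ , fD = cnf-⊕ s v F∈ ; x , x∈C , x∈D = dnf∩cnf s C∈ D∈
        C' , C'∈ , g = fC x∈C ; D' , D'∈ , g' = fD x∈D in
    Certificate-translate (h C'∈ D'∈) λ {a} {b} a∈ b∈ → x , _ , _ , g a∈ , g' b∈ , +-comm x a , +-comm x b

  x+f+[y+e]≈y+f+[x+e] : ∀ x y e f → ((x + f) + (y + e)) ≈ ((y + f) + (x + e))
  x+f+[y+e]≈y+f+[x+e] x y e f = solve 4 (λ x y e f → (x ⊕ f) ⊕ (y ⊕ e) ⊜ (y ⊕ f) ⊕ (x ⊕ e)) ≈-refl x y e f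

  -- When no element is shared, the two crossed sums give a certificate of length two; this is the one
  -- place where distributivity of + over ∧ and ∨ needs more than a single inequality of G.
  Certified-⊕-distrib-∧ : ∀ u s₁ s₂ → Certified ((u ⊕ₜ s₁) ∧ₜ (u ⊕ₜ s₂)) (u ⊕ₜ (s₁ ∧ₜ s₂))
  Certified-⊕-distrib-∧ u s₁ s₂ {E} {F} E∈ F∈ =
    let E₁ , E₂ , E₁∈ , E₂∈ , eq = product⁻ {DNF (u ⊕ₜ s₁)} {DNF (u ⊕ₜ s₂)} E∈ in
    P.subst (λ Z → Certificate⁺ Z F) (P.sym eq)
        (certify E₁ E₂ (dnf-⊕ u s₁ E₁∈) (dnf-⊕ u s₂ E₂∈) (cnf-⊕ u (s₁ ∧ₜ s₂) F∈))
    where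
    certify : ∀ E₁ E₂ → SumDNF u s₁ E₁ → SumDNF u s₂ E₂ → SumCNF u (s₁ ∧ₜ s₂) F → Certificate⁺ (E₁ ⁺++⁺ E₂) F
    certify E₁ E₂ (C₁ , C₁∈ , f₁) (C₂ , C₂∈ , f₂) (D , D∈ , fD) with dnf∩cnf u C₁∈ D∈ | dnf∩cnf u C₂∈ D∈
    ... | x , x∈C₁ , x∈D | y , y∈C₂ , y∈D with fD x∈D | fD y∈D
    ... | Dx , Dx∈ , gx | Dy , Dy∈ , gy with ++⁻ {CNF s₁} Dx∈ | ++⁻ {CNF s₁} Dy∈
    ... | inj₁ Dx∈₁ | _ =
          let Cx , Cx∈ , hx = f₁ x∈C₁ ; e , e∈C , e∈D = dnf∩cnf s₁ Cx∈ Dx∈₁ in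
          Certificate-shared (inˡ {C = E₁} {E₂} (hx e∈C)) (gx e∈D)
    ... | inj₂ Dx∈₂ | inj₂ Dy∈₂ =
          let Cy , Cy∈ , hy = f₂ y∈C₂ ; e , e∈C , e∈D = dnf∩cnf s₂ Cy∈ Dy∈₂ in
          Certificate-shared (inʳ {C = E₁} {E₂} (hy e∈C)) (gy e∈D)
    ... | inj₂ Dx∈₂ | inj₁ Dy∈₁ =
          let Cx , Cx∈ , hx = f₁ x∈C₁ ; f , f∈C , f∈D = dnf∩cnf s₁ Cx∈ Dy∈₁
              Cy , Cy∈ , hy = f₂ y∈C₂ ; e , e∈C , e∈D = dnf∩cnf s₂ Cy∈ Dx∈₂ in
          Certificate-pair (inˡ {C = E₁} {E₂} (hx f∈C)) (inʳ {C = E₁} {E₂} (hy e∈C)) (gy f∈D) (gx e∈D)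
               (≤-reflexive (x+f+[y+e]≈y+f+[x+e] x y e f))

  Certified-⊕-distrib-∨ : ∀ u s₁ s₂ → Certified (u ⊕ₜ (s₁ ∨ₜ s₂)) ((u ⊕ₜ s₁) ∨ₜ (u ⊕ₜ s₂))
  Certified-⊕-distrib-∨ u s₁ s₂ {E} {F} E∈ F∈ =
    let F₁ , F₂ , F₁∈ , F₂∈ , eq = product⁻ {CNF (u ⊕ₜ s₁)} {CNF (u ⊕ₜ s₂)} F∈ in
    P.subst (λ Z → Certificate⁺ E Z) (P.sym eq)
        (certify F₁ F₂ (dnf-⊕ u (s₁ ∨ₜ s₂) E∈) (cnf-⊕ u s₁ F₁∈) (cnf-⊕ u s₂ F₂∈))
    where
    certify : ∀ F₁ F₂ → SumDNF u (s₁ ∨ₜ s₂) E → SumCNF u s₁ F₁ → SumCNF u s₂ F₂ → Certificate⁺ E (F₁ ⁺++⁺ F₂)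
    certify F₁ F₂ (C , C∈ , fC) (D₁ , D₁∈ , g₁) (D₂ , D₂∈ , g₂) with dnf∩cnf u C∈ D₁∈ | dnf∩cnf u C∈ D₂∈
    ... | x , x∈C , x∈D₁ | y , y∈C , y∈D₂ with fC x∈C | fC y∈C
    ... | Cx , Cx∈ , hx | Cy , Cy∈ , hy with ++⁻ {DNF s₁} Cx∈ | ++⁻ {DNF s₁} Cy∈
    ... | inj₁ Cx∈₁ | _ =
          let Dx , Dx∈ , kx = g₁ x∈D₁ ; e , e∈C , e∈D = dnf∩cnf s₁ Cx∈₁ Dx∈ in
          Certificate-shared (hx e∈C) (inˡ {C = F₁} {F₂} (kx e∈D))
    ... | inj₂ Cx∈₂ | inj₂ Cy∈₂ =
          let Dy , Dy∈ , ky = g₂ y∈D₂ ; e , e∈C , e∈D = dnf∩cnf s₂ Cy∈₂ Dy∈ in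
          Certificate-shared (hy e∈C) (inʳ {C = F₁} {F₂} (ky e∈D))
    ... | inj₂ Cx∈₂ | inj₁ Cy∈₁ =
          let Dx , Dx∈ , kx = g₁ x∈D₁ ; f , f∈C , f∈D = dnf∩cnf s₁ Cy∈₁ Dx∈
              Dy , Dy∈ , ky = g₂ y∈D₂ ; e , e∈C , e∈D = dnf∩cnf s₂ Cx∈₂ Dy∈ in
          Certificate-pair (hy f∈C) (hx e∈C) (inˡ {C = F₁} {F₂} (kx f∈D)) (inʳ {C = F₁} {F₂} (ky e∈D))
               (≤-reflexive (x+f+[y+e]≈y+f+[x+e] y x e f))

  ⊕-monoˡ : ∀ {s t} u → s ≼ t → (s ⊕ₜ u) ≼ (t ⊕ₜ u)
  ⊕-monoˡ {s} {t} u p = Certified⇒Below (Certified-⊕-monoˡ s t u (Below⇒Certified p))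

  ⊕-monoʳ : ∀ s {u v} → u ≼ v → (s ⊕ₜ u) ≼ (s ⊕ₜ v)
  ⊕-monoʳ s {u} {v} p = Certified⇒Below (Certified-⊕-monoʳ s u v (Below⇒Certified p))

  infix 4 _≃_
  _≃_ : Term → Term → Set ℓ
  _≃_ = Equiv _▷s_

  ≃-refl : ∀ {s} → s ≃ s
  ≃-refl = ≼-refl , ≼-refl

  ≃-sym : ∀ {s t} → s ≃ t → t ≃ s
  ≃-sym (p , q) = q , p

  ≃-trans : ∀ {s t u} → s ≃ t → t ≃ u → s ≃ u
  ≃-trans (p , q) (p' , q') = ≼-trans p p' , ≼-trans q' q

  ≃-isEquivalence : IsEquivalence _≃_
  ≃-isEquivalence = record { refl = ≃-refl ; sym = ≃-sym ; trans = ≃-trans }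

  ≃-setoid : Setoid ℓ ℓ
  ≃-setoid = record { isEquivalence = ≃-isEquivalence }

  ∧-cong : ∀ {a b a' b'} → a ≃ a' → b ≃ b' → (a ∧ₜ b) ≃ (a' ∧ₜ b')
  ∧-cong (p , q) (p' , q') = ∧-mono p p' , ∧-mono q q'

  ∨-cong : ∀ {a b a' b'} → a ≃ a' → b ≃ b' → (a ∨ₜ b) ≃ (a' ∨ₜ b')
  ∨-cong (p , q) (p' , q') = ∨-mono p p' , ∨-mono q q'

  ⊕-cong : ∀ {s t u v} → s ≃ t → u ≃ v → (s ⊕ₜ u) ≃ (t ⊕ₜ v)
  ⊕-cong {s} {t} {u} {v} (p , q) (p' , q') =
    ≼-trans (⊕-monoˡ u p) (⊕-monoʳ t p') , ≼-trans (⊕-monoˡ v q) (⊕-monoʳ s q')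

  ⊕-distrib-∧ : ∀ u s₁ s₂ → (u ⊕ₜ (s₁ ∧ₜ s₂)) ≃ ((u ⊕ₜ s₁) ∧ₜ (u ⊕ₜ s₂))
  ⊕-distrib-∧ u s₁ s₂ = ∧-glb (⊕-monoʳ u ∧-lb₁) (⊕-monoʳ u ∧-lb₂) , Certified⇒Below (Certified-⊕-distrib-∧ u s₁ s₂)

  ⊕-distrib-∨ : ∀ u s₁ s₂ → (u ⊕ₜ (s₁ ∨ₜ s₂)) ≃ ((u ⊕ₜ s₁) ∨ₜ (u ⊕ₜ s₂))
  ⊕-distrib-∨ u s₁ s₂ = Certified⇒Below (Certified-⊕-distrib-∨ u s₁ s₂) , ∨-lub (⊕-monoʳ u ∨-ub₁) (⊕-monoʳ u ∨-ub₂)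

  gen-cong : ∀ {a b} → a ≈ b → gen a ≃ gen b
  gen-cong e = gen-≈ e , gen-≈ (≈-sym e)

  shift-cong : ∀ {a b} u → a ≈ b → shiftₜ a u ≃ shiftₜ b u
  shift-cong (gen c) e = gen-cong (+-cong e ≈-refl)
  shift-cong (s ∧ₜ t) e = ∧-cong (shift-cong s e) (shift-cong t e)
  shift-cong (s ∨ₜ t) e = ∨-cong (shift-cong s e) (shift-cong t e)

  shift-identity : ∀ u → shiftₜ 0# u ≃ u
  shift-identity (gen c) = gen-cong (+-idˡ c)
  shift-identity (s ∧ₜ t) = ∧-cong (shift-identity s) (shift-identity t)
  shift-identity (s ∨ₜ t) = ∨-cong (shift-identity s) (shift-identity t)

  shift-assoc : ∀ a b u → shiftₜ (a + b) u ≃ shiftₜ a (shiftₜ b u)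
  shift-assoc a b (gen c) = gen-cong (+-assoc a b c)
  shift-assoc a b (s ∧ₜ t) = ∧-cong (shift-assoc a b s) (shift-assoc a b t)
  shift-assoc a b (s ∨ₜ t) = ∨-cong (shift-assoc a b s) (shift-assoc a b t)

  gen-⊕-comm : ∀ a u → (gen a ⊕ₜ u) ≃ (u ⊕ₜ gen a)
  gen-⊕-comm a (gen b) = gen-cong (+-comm a b)
  gen-⊕-comm a (s ∧ₜ t) = ∧-cong (gen-⊕-comm a s) (gen-⊕-comm a t)
  gen-⊕-comm a (s ∨ₜ t) = ∨-cong (gen-⊕-comm a s) (gen-⊕-comm a t)

  ⊕-comm : ∀ s u → (s ⊕ₜ u) ≃ (u ⊕ₜ s)
  ⊕-comm (gen a) u = gen-⊕-comm a u
  ⊕-comm (s₁ ∧ₜ s₂) u = ≃-trans (∧-cong (⊕-comm s₁ u) (⊕-comm s₂ u)) (≃-sym (⊕-distrib-∧ u s₁ s₂))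
  ⊕-comm (s₁ ∨ₜ s₂) u = ≃-trans (∨-cong (⊕-comm s₁ u) (⊕-comm s₂ u)) (≃-sym (⊕-distrib-∨ u s₁ s₂))

  shift-⊕-assoc : ∀ a t u → (shiftₜ a t ⊕ₜ u) ≃ shiftₜ a (t ⊕ₜ u)
  shift-⊕-assoc a (gen b) u = shift-assoc a b u
  shift-⊕-assoc a (t₁ ∧ₜ t₂) u = ∧-cong (shift-⊕-assoc a t₁ u) (shift-⊕-assoc a t₂ u)
  shift-⊕-assoc a (t₁ ∨ₜ t₂) u = ∨-cong (shift-⊕-assoc a t₁ u) (shift-⊕-assoc a t₂ u)

  ⊕-assoc : ∀ s t u → ((s ⊕ₜ t) ⊕ₜ u) ≃ (s ⊕ₜ (t ⊕ₜ u))
  ⊕-assoc (gen a) t u = shift-⊕-assoc a t u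
  ⊕-assoc (s₁ ∧ₜ s₂) t u = ∧-cong (⊕-assoc s₁ t u) (⊕-assoc s₂ t u)
  ⊕-assoc (s₁ ∨ₜ s₂) t u = ∨-cong (⊕-assoc s₁ t u) (⊕-assoc s₂ t u)

  0ₜ : Term
  0ₜ = gen 0#

  ⊕-identityˡ : ∀ u → (0ₜ ⊕ₜ u) ≃ u
  ⊕-identityˡ u = shift-identity u

  ⊕-identityʳ : ∀ u → (u ⊕ₜ 0ₜ) ≃ u
  ⊕-identityʳ u = ≃-trans (⊕-comm u 0ₜ) (⊕-identityˡ u)

  ⊕-inverseʳ : ∀ s → (s ⊕ₜ negₜ s) ≃ 0ₜ
  ⊕-inverseʳ (gen a) = gen-cong (-‿invʳ a)
  ⊕-inverseʳ (s₁ ∧ₜ s₂) =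
    ≼-trans (proj₁ (⊕-distrib-∨ (s₁ ∧ₜ s₂) (negₜ s₁) (negₜ s₂)))
            (∨-lub (≼-trans (⊕-monoˡ {s₁ ∧ₜ s₂} {s₁} (negₜ s₁) ∧-lb₁) (proj₁ (⊕-inverseʳ s₁)))
                   (≼-trans (⊕-monoˡ {s₁ ∧ₜ s₂} {s₂} (negₜ s₂) ∧-lb₂) (proj₁ (⊕-inverseʳ s₂)))) ,
    ∧-glb (≼-trans (proj₂ (⊕-inverseʳ s₁)) (⊕-monoʳ s₁ ∨-ub₁)) (≼-trans (proj₂ (⊕-inverseʳ s₂)) (⊕-monoʳ s₂ ∨-ub₂))
  ⊕-inverseʳ (s₁ ∨ₜ s₂) =
    ∨-lub (≼-trans (⊕-monoʳ s₁ ∧-lb₁) (proj₁ (⊕-inverseʳ s₁)))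
        (≼-trans (⊕-monoʳ s₂ ∧-lb₂) (proj₁ (⊕-inverseʳ s₂))) ,
    ≼-trans (∧-glb (≼-trans (proj₂ (⊕-inverseʳ s₁)) (⊕-monoˡ {s₁} {s₁ ∨ₜ s₂} (negₜ s₁) ∨-ub₁))
                   (≼-trans (proj₂ (⊕-inverseʳ s₂)) (⊕-monoˡ {s₂} {s₁ ∨ₜ s₂} (negₜ s₂) ∨-ub₂)))
            (proj₂ (⊕-distrib-∧ (s₁ ∨ₜ s₂) (negₜ s₁) (negₜ s₂)))

  ⊕-inverseˡ : ∀ s → (negₜ s ⊕ₜ s) ≃ 0ₜ
  ⊕-inverseˡ s = ≃-trans (⊕-comm (negₜ s) s) (⊕-inverseʳ s)

  negₜ-cong : ∀ {s t} → s ≃ t → negₜ s ≃ negₜ t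
  negₜ-cong {s} {t} s≃t = begin
    negₜ s                       ≈⟨ ⊕-identityʳ (negₜ s) ⟨
    negₜ s ⊕ₜ 0ₜ                 ≈⟨ ⊕-cong (≃-refl {negₜ s}) (⊕-inverseʳ t) ⟨
    negₜ s ⊕ₜ (t ⊕ₜ negₜ t)      ≈⟨ ⊕-assoc (negₜ s) t (negₜ t) ⟨
    (negₜ s ⊕ₜ t) ⊕ₜ negₜ t      ≈⟨ ⊕-cong (⊕-cong (≃-refl {negₜ s}) (≃-sym s≃t)) (≃-refl {negₜ t}) ⟩
    (negₜ s ⊕ₜ s) ⊕ₜ negₜ t      ≈⟨ ⊕-cong (⊕-inverseˡ s) (≃-refl {negₜ t}) ⟩
    0ₜ ⊕ₜ negₜ t                 ≈⟨ ⊕-identityˡ (negₜ t) ⟩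
    negₜ t                       ∎
    where open import Relation.Binary.Reasoning.Setoid ≃-setoid


module LorenzenConstruction {ℓ} (G : OrderedGroup ℓ ℓ ℓ) where
  open import Data.Product using (_,_; proj₁)
  open import Data.List.Relation.Unary.Any using (here)
  open import Data.List.NonEmpty using ([_])
  open import Relation.Binary.Lattice.Structures using (IsLattice)
  open import Relation.Binary.Structures using (IsPartialOrder)
  open import Algebra.Structures using (IsAbelianGroup)

  open OrderedGroupProperties G
  open Lorenzen G
  open NormalForms G
  open TermGroup G

  ≼-isPartialOrder : IsPartialOrder _≃_ _≼_
  ≼-isPartialOrder = record
    { isPreorder = record { isEquivalence = ≃-isEquivalence ; reflexive = proj₁ ; trans = ≼-trans }
    ; antisym = _,_ }

  ⊕-isAbelianGroup : IsAbelianGroup _≃_ _⊕ₜ_ 0ₜ negₜ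
  ⊕-isAbelianGroup = record
    { isGroup = record
      { isMonoid = record
        { isSemigroup = record
          { isMagma = record { isEquivalence = ≃-isEquivalence ; ∙-cong = ⊕-cong }
          ; assoc = ⊕-assoc }
        ; identity = ⊕-identityˡ , ⊕-identityʳ }
      ; inverse = ⊕-inverseˡ , ⊕-inverseʳ
      ; ⁻¹-cong = negₜ-cong }
    ; comm = ⊕-comm }

  ≼-isLattice : IsLattice _≃_ _≼_ _∨ₜ_ _∧ₜ_
  ≼-isLattice = record
    { isPartialOrder = ≼-isPartialOrder
    ; supremum = λ x y → ∨-ub₁ , ∨-ub₂ , λ z → ∨-lub
    ; infimum = λ x y → ∧-lb₁ , ∧-lb₂ , λ z → ∧-glb }

  -- a − b ≤ 0 is already a derivation in ▷s, so no auxiliary elements are needed.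
  gen-mono : ∀ {a b} → a ≤ b → gen a ≼ gen b
  gen-mono {a} {b} p = rel {A = [ a ]} {B = [ b ]} (0 , (λ ()) , λ s → base (here (x≤y⇒x-y≤0 p)))

  lorenzenGroupLaw : LorenzenGroupLaw _▷s_
  lorenzenGroupLaw = record
    { _⊕_ = _⊕ₜ_
    ; zero⊕ = 0ₜ
    ; neg = negₜ
    ; isLatticeGroup = record
      { isOrderedGroup = record
        { isAbelianGroup = ⊕-isAbelianGroup
        ; isPartialOrder = ≼-isPartialOrder
        ; +-mono = ⊕-monoˡ }
      ; isLattice = ≼-isLattice
      ; +-distrib-∧ = ⊕-distrib-∧
      ; +-distrib-∨ = ⊕-distrib-∨ }
    ; gen-morphism = record
      { cong = gen-cong
      ; homo = λ a b → ≃-refl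
      ; mono = gen-mono } }

  Lorenzen : LatticeGroup ℓ ℓ ℓ
  Lorenzen = LorenzenGroupLaw.latticeGroup lorenzenGroupLaw


module OrderedGroupMorphismProperties {c ℓ₁ ℓ₂ c' ℓ₁' ℓ₂'} (G : OrderedGroup c ℓ₁ ℓ₂) (H : OrderedGroup c' ℓ₁' ℓ₂')
  (f : OrderedGroup.Carrier G → OrderedGroup.Carrier H) (m : IsOrderedGroupMorphism G H f) where
  open import Data.List using ([]; _∷_; map)

  private
    module G = OrderedGroupProperties G
    module H = OrderedGroupProperties H
  open IsOrderedGroupMorphism m

  f-0# : f G.0# H.≈ H.0#
  f-0# = H.≈-trans (H.≈-sym (H.x+y-y≈x x x)) (H.≈-trans (H.+-cong x+x≈x H.≈-refl) (H.-‿invʳ x))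
    where
    x : H.Carrier
    x = f G.0#
    x+x≈x : (x H.+ x) H.≈ x
    x+x≈x = H.≈-trans (H.≈-sym (homo G.0# G.0#)) (cong (G.+-idˡ G.0#))

  f-sumL : ∀ xs → f (G.sumL xs) H.≈ H.sumL (map f xs)
  f-sumL [] = f-0#
  f-sumL (x ∷ xs) = H.≈-trans (homo x (G.sumL xs)) (H.+-cong H.≈-refl (f-sumL xs))


module LatticeGroupMorphismProperties {c ℓ₁ ℓ₂ c' ℓ₁' ℓ₂'} (H : LatticeGroup c ℓ₁ ℓ₂) (K : LatticeGroup c' ℓ₁' ℓ₂')
  (θ : LatticeGroup.Carrier H → LatticeGroup.Carrier K) (m : IsLatticeGroupMorphism H K θ) where
  open import Data.Nat using (zero; suc)
  open import Data.Fin using (Fin; zero; suc)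

  private
    module H = LatticeGroupProperties H
    module K = LatticeGroupProperties K
  open IsLatticeGroupMorphism m

  θ-⋀ : ∀ {k} (f : Fin (suc k) → H.Carrier) → θ (H.⋀ f) K.≈ K.⋀ (λ i → θ (f i))
  θ-⋀ {zero} f = K.≈-refl
  θ-⋀ {suc k} f = K.≈-trans (∧-homo (f zero) (H.⋀ (λ i → f (suc i)))) (K.∧-cong K.≈-refl (θ-⋀ (λ i → f (suc i))))

  θ-⋁ : ∀ {k} (f : Fin (suc k) → H.Carrier) → θ (H.⋁ f) K.≈ K.⋁ (λ i → θ (f i))
  θ-⋁ {zero} f = K.≈-refl
  θ-⋁ {suc k} f = K.≈-trans (∨-homo (f zero) (H.⋁ (λ i → f (suc i)))) (K.∨-cong K.≈-refl (θ-⋁ (λ i → f (suc i))))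


module LorenzenUniversality {ℓ} (G : OrderedGroup ℓ ℓ ℓ) where
  open import Data.Nat using (suc; s≤s; z≤n) renaming (_≤_ to _≤ℕ_)
  open import Data.List using (List; []; _∷_; map; length)
  import Data.List.Properties as LP
  open import Data.List.NonEmpty as L⁺ using (_∷_)
  open import Data.List.Relation.Unary.All as All using (All; []; _∷_)
  import Data.List.Relation.Unary.All.Properties as AllP
  open import Data.List.Relation.Unary.Any using (here; there)
  open import Data.List.Membership.Propositional using (_∈_)
  open import Data.Product using (_,_)
  open import Relation.Binary.PropositionalEquality as P using (_≡_; refl)

  private
    module G = OrderedGroupProperties G
  open Lorenzen G
  open Certificates G using (certificate)
  open FinestRegularisation G using (Regularisation⇒Certificate)
  open TermGroup G
  open LorenzenConstruction G

  module _ (K : LatticeGroup ℓ ℓ ℓ) (ψ : G.Carrier → LatticeGroup.Carrier K)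
           (ψm : IsOrderedGroupMorphism G (LatticeGroup.orderedGroup K) ψ) where

    private
      module K = LatticeGroupProperties K
    open OrderedGroupMorphismProperties G (LatticeGroup.orderedGroup K) ψ ψm
    open IsOrderedGroupMorphism ψm

    certificate-bound : ∀ {m M} (as bs : List G.Carrier) → All (λ a → m K.≤ ψ a) as → All (λ b → ψ b K.≤ M) bs →
            length as ≡ length bs → 1 ≤ℕ length as → G.sumL as G.≤ G.sumL bs → m K.≤ M
    certificate-bound {m} {M} (a ∷ as) bs pa pb len (s≤s z≤n) le = K.·-cancel-≤ (length as)
        (K.≤-trans suc·m≤Σψas (K.≤-trans Σψas≤Σψbs Σψbs≤suc·M))
      where
      suc·m≤Σψas : (suc (length as) K.· m) K.≤ K.sumL (map ψ (a ∷ as))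
      suc·m≤Σψas = K.≤-respˡ (K.·-congˡ (LP.length-map ψ (a ∷ as))) (K.sumL-lb (map ψ (a ∷ as)) (AllP.map⁺ pa))
      Σψas≤Σψbs : K.sumL (map ψ (a ∷ as)) K.≤ K.sumL (map ψ bs)
      Σψas≤Σψbs = K.≤-resp (f-sumL (a ∷ as)) (f-sumL bs) (mono le)
      Σψbs≤suc·M : K.sumL (map ψ bs) K.≤ (suc (length as) K.· M)
      Σψbs≤suc·M = K.≤-respʳ (K.·-congˡ (P.trans (LP.length-map ψ bs) (P.sym len))) (K.sumL-ub (map ψ bs) (AllP.map⁺ pb))

    θ : Term → LatticeGroup.Carrier K
    θ (gen a) = ψ a
    θ (s ∧ₜ t) = θ s K.∧ θ t
    θ (s ∨ₜ t) = θ s K.∨ θ t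

    θ-⋀gen-lb : ∀ a₀ rest {x} → x ∈ (a₀ ∷ rest) → θ (⋀ₜ (L⁺.map gen (a₀ ∷ rest))) K.≤ ψ x
    θ-⋀gen-lb a₀ [] (here refl) = K.≤-refl
    θ-⋀gen-lb a₀ (b ∷ rest) (here refl) = K.x∧y≤x _ _
    θ-⋀gen-lb a₀ (b ∷ rest) (there p) = K.≤-trans (K.x∧y≤y _ _) (θ-⋀gen-lb b rest p)

    θ-⋁gen-ub : ∀ a₀ rest {x} → x ∈ (a₀ ∷ rest) → ψ x K.≤ θ (⋁ₜ (L⁺.map gen (a₀ ∷ rest)))
    θ-⋁gen-ub a₀ [] (here refl) = K.≤-refl
    θ-⋁gen-ub a₀ (b ∷ rest) (here refl) = K.x≤x∨y _ _
    θ-⋁gen-ub a₀ (b ∷ rest) (there p) = K.≤-trans (θ-⋁gen-ub b rest p) (K.y≤x∨y _ _)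

    θ-mono : ∀ {s t} → Below _▷s_ s t → θ s K.≤ θ t
    θ-mono ≼-refl = K.≤-refl
    θ-mono (≼-trans p q) = K.≤-trans (θ-mono p) (θ-mono q)
    θ-mono (gen-≈ e) = K.≤-reflexive (cong e)
    θ-mono ∧-lb₁ = K.x∧y≤x _ _
    θ-mono ∧-lb₂ = K.x∧y≤y _ _
    θ-mono (∧-glb p q) = K.∧-greatest (θ-mono p) (θ-mono q)
    θ-mono ∨-ub₁ = K.x≤x∨y _ _
    θ-mono ∨-ub₂ = K.y≤x∨y _ _
    θ-mono (∨-lub p q) = K.∨-least (θ-mono p) (θ-mono q)
    θ-mono distrib = K.∧-distribˡ-∨-≤ _ _ _
    θ-mono (rel {a₀ ∷ as₀} {b₀ ∷ bs₀} r) with Regularisation⇒Certificate {a₀ ∷ as₀} {b₀ ∷ bs₀} r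
    ... | certificate as bs asA bsB len ne le =
      certificate-bound as bs (All.map (θ-⋀gen-lb a₀ as₀) asA) (All.map (θ-⋁gen-ub b₀ bs₀) bsB) len ne le

    θ-cong : ∀ {s t} → s ≃ t → θ s K.≈ θ t
    θ-cong (p , q) = K.antisym (θ-mono p) (θ-mono q)

    θ-shift : ∀ a t → θ (shiftₜ a t) K.≈ (ψ a K.+ θ t)
    θ-shift a (gen b) = homo a b
    θ-shift a (t₁ ∧ₜ t₂) = K.≈-trans (K.∧-cong (θ-shift a t₁) (θ-shift a t₂)) (K.≈-sym (K.+-distrib-∧ _ _ _))
    θ-shift a (t₁ ∨ₜ t₂) = K.≈-trans (K.∨-cong (θ-shift a t₁) (θ-shift a t₂)) (K.≈-sym (K.+-distrib-∨ _ _ _))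

    θ-homo : ∀ s t → θ (s ⊕ₜ t) K.≈ (θ s K.+ θ t)
    θ-homo (gen a) t = θ-shift a t
    θ-homo (s₁ ∧ₜ s₂) t = K.≈-trans (K.∧-cong (θ-homo s₁ t) (θ-homo s₂ t)) (K.≈-sym (K.+-distrib-∧ʳ _ _ _))
    θ-homo (s₁ ∨ₜ s₂) t = K.≈-trans (K.∨-cong (θ-homo s₁ t) (θ-homo s₂ t)) (K.≈-sym (K.+-distrib-∨ʳ _ _ _))

    θ-isMorphism : IsLatticeGroupMorphism Lorenzen K θ
    θ-isMorphism = record
      { isOrderedGroupMorphism = record { cong = θ-cong ; homo = θ-homo ; mono = θ-mono }
      ; ∧-homo = λ a b → K.≈-refl
      ; ∨-homo = λ a b → K.≈-refl }

    θ-unique : ∀ (θ' : Term → LatticeGroup.Carrier K) → IsLatticeGroupMorphism Lorenzen K θ' →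
               (∀ a → θ' (gen a) K.≈ ψ a) → ∀ x → θ' x K.≈ θ x
    θ-unique θ' m h (gen a) = h a
    θ-unique θ' m h (s ∧ₜ t) = K.≈-trans (IsLatticeGroupMorphism.∧-homo m s t)
        (K.∧-cong (θ-unique θ' m h s) (θ-unique θ' m h t))
    θ-unique θ' m h (s ∨ₜ t) = K.≈-trans (IsLatticeGroupMorphism.∨-homo m s t)
        (K.∨-cong (θ-unique θ' m h s) (θ-unique θ' m h t))

  lorenzen-isFree : IsFreeLatticeGroupOn G Lorenzen gen
  lorenzen-isFree = LorenzenGroupLaw.gen-morphism lorenzenGroupLaw ,
    λ K ψ ψm → θ K ψ ψm , θ-isMorphism K ψ ψm , (λ a → LatticeGroupProperties.≈-refl K) , θ-unique K ψ ψm


module Characterisation {ℓ} (G : OrderedGroup ℓ ℓ ℓ) where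
  open import Data.Nat as ℕ using (ℕ; zero; suc; s≤s; z≤n) renaming (_≤_ to _≤ℕ_)
  open import Data.Fin using (Fin; zero; suc)
  open import Data.List using (List; []; _∷_; _++_; map; length; replicate)
  import Data.List.Properties as LP
  open import Data.List.NonEmpty using (toList)
  open import Data.List.Relation.Unary.All as All using (All; []; _∷_)
  import Data.List.Relation.Unary.All.Properties as AllP
  open import Data.List.Relation.Unary.Any using (here)
  open import Data.List.Membership.Propositional using (_∈_)
  import Data.List.Membership.Propositional.Properties as MP
  open import Data.Product using (Σ; _×_; _,_; proj₁; proj₂)
  open import Data.Sum using (inj₁; inj₂; [_,_]′)
  open import Relation.Binary.PropositionalEquality as P using (_≡_; refl)
  open import Function.Bundles using (_⇔_; mk⇔)

  open OrderedGroupProperties G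
  open Lorenzen G
  open Certificates G using (Certificate; certificate)
  open FinestRegularisation G using (split-zero; length-split-zero; sumL-split-zero)
  open NormalForms G using (DNF; CNF; _∈c_; product⁻; ++⁻; Below⇒Certified)
  open LorenzenConstruction G using (lorenzenGroupLaw; Lorenzen)
  open LorenzenUniversality G using (certificate-bound)

  MultiplicityCertificate : ∀ {k l} (a : Fin (suc k) → Carrier) (b : Fin (suc l) → Carrier) → Set ℓ
  MultiplicityCertificate {k} {l} a b = Σ (Fin (suc k) → ℕ) λ n → Σ (Fin (suc l) → ℕ) λ m →
    (sumℕ n ≡ sumℕ m) × (1 ≤ℕ sumℕ n) × ∑ (λ i → n i · a i) ≤ ∑ (λ j → m j · b j)

  expand : ∀ {k} → (Fin k → ℕ) → (Fin k → Carrier) → List Carrier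
  expand {zero} n a = []
  expand {suc k} n a = replicate (n zero) (a zero) ++ expand (λ i → n (suc i)) (λ i → a (suc i))

  length-expand : ∀ {k} (n : Fin k → ℕ) a → length (expand n a) ≡ sumℕ n
  length-expand {zero} n a = refl
  length-expand {suc k} n a = P.trans (LP.length-++ (replicate (n zero) (a zero)))
    (P.cong₂ ℕ._+_ (LP.length-replicate (n zero)) (length-expand (λ i → n (suc i)) (λ i → a (suc i))))

  sumL-replicate : ∀ n x → sumL (replicate n x) ≈ (n · x)
  sumL-replicate zero x = ≈-refl
  sumL-replicate (suc n) x = +-cong ≈-refl (sumL-replicate n x)

  sumL-expand : ∀ {k} (n : Fin k → ℕ) a → sumL (expand n a) ≈ ∑ (λ i → n i · a i)
  sumL-expand {zero} n a = ≈-refl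
  sumL-expand {suc k} n a = ≈-trans (sumL-++ (replicate (n zero) (a zero)) _)
    (+-cong (sumL-replicate (n zero) (a zero)) (sumL-expand (λ i → n (suc i)) (λ i → a (suc i))))

  All-expand : ∀ {Q : Carrier → Set ℓ} {k} (n : Fin k → ℕ) a → (∀ i → Q (a i)) → All Q (expand n a)
  All-expand {k = zero} n a h = []
  All-expand {k = suc k} n a h =
    AllP.++⁺ (AllP.replicate⁺ (n zero) (h zero)) (All-expand (λ i → n (suc i)) (λ i → a (suc i)) (λ i → h (suc i)))

  count : ∀ {k} → List (Fin k) → Fin k → ℕ
  count {suc k} is zero = proj₁ (split-zero is)
  count {suc k} is (suc i) = count (proj₂ (split-zero is)) i

  sumℕ-count : ∀ {k} (is : List (Fin k)) → sumℕ (count is) ≡ length is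
  sumℕ-count {zero} [] = refl
  sumℕ-count {suc k} is = P.trans (P.cong (proj₁ (split-zero is) ℕ.+_) (sumℕ-count (proj₂ (split-zero is))))
                                  (P.sym (length-split-zero is))

  ∑-count : ∀ {k} (a : Fin k → Carrier) (is : List (Fin k)) → ∑ (λ i → count is i · a i) ≈ sumL (map a is)
  ∑-count {zero} a [] = ≈-refl
  ∑-count {suc k} a is = ≈-trans (+-cong ≈-refl (∑-count (λ i → a (suc i)) (proj₂ (split-zero is))))
                                 (≈-sym (sumL-split-zero a is))

  indices : ∀ {k} (a : Fin k → Carrier) xs → All (λ x → Σ (Fin k) λ i → x ≡ a i) xs →
            Σ (List (Fin k)) λ is → map a is ≡ xs
  indices a [] [] = [] , refl
  indices a (x ∷ xs) ((i , e) ∷ ps) = let is , eq = indices a xs ps in i ∷ is , P.cong₂ _∷_ (P.sym e) eq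

  multiplicities : ∀ {k l} (a : Fin (suc k) → Carrier) (b : Fin (suc l) → Carrier) is js →
                   length is ≡ length js → 1 ≤ℕ length is → sumL (map a is) ≤ sumL (map b js) →
                   MultiplicityCertificate a b
  multiplicities a b is js len ne le =
    count is , count js ,
    P.trans (sumℕ-count is) (P.trans len (P.sym (sumℕ-count js))) ,
    P.subst (1 ≤ℕ_) (P.sym (sumℕ-count is)) ne ,
    ≤-resp (≈-sym (∑-count a is)) (≈-sym (∑-count b js)) le

  atoms : Term → List Carrier
  atoms (gen a) = a ∷ []
  atoms (s ∧ₜ t) = atoms s ++ atoms t
  atoms (s ∨ₜ t) = atoms s ++ atoms t

  dnf-atoms : ∀ t {C} → C ∈c DNF t → ∀ {x} → x ∈ toList C → x ∈ atoms t
  dnf-atoms (gen a) (here refl) p = p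
  dnf-atoms (s ∧ₜ t) C∈ {x} p =
    let C₁ , C₂ , C₁∈ , C₂∈ , eq = product⁻ {DNF s} {DNF t} C∈ in
    [ (λ q → MP.∈-++⁺ˡ (dnf-atoms s C₁∈ q)) , (λ q → MP.∈-++⁺ʳ (atoms s) (dnf-atoms t C₂∈ q)) ]′
      (MP.∈-++⁻ (toList C₁) (P.subst (λ Z → x ∈ toList Z) eq p))
  dnf-atoms (s ∨ₜ t) C∈ p with ++⁻ {DNF s} C∈
  ... | inj₁ q = MP.∈-++⁺ˡ (dnf-atoms s q p)
  ... | inj₂ q = MP.∈-++⁺ʳ (atoms s) (dnf-atoms t q p)

  cnf-atoms : ∀ t {C} → C ∈c CNF t → ∀ {x} → x ∈ toList C → x ∈ atoms t
  cnf-atoms (gen a) (here refl) p = p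
  cnf-atoms (s ∨ₜ t) C∈ {x} p =
    let C₁ , C₂ , C₁∈ , C₂∈ , eq = product⁻ {CNF s} {CNF t} C∈ in
    [ (λ q → MP.∈-++⁺ˡ (cnf-atoms s C₁∈ q)) , (λ q → MP.∈-++⁺ʳ (atoms s) (cnf-atoms t C₂∈ q)) ]′
      (MP.∈-++⁻ (toList C₁) (P.subst (λ Z → x ∈ toList Z) eq p))
  cnf-atoms (s ∧ₜ t) C∈ p with ++⁻ {CNF s} C∈
  ... | inj₁ q = MP.∈-++⁺ˡ (cnf-atoms s q p)
  ... | inj₂ q = MP.∈-++⁺ʳ (atoms s) (cnf-atoms t q p)

  ⋀gen : ∀ {k} → (Fin (suc k) → Carrier) → Term
  ⋀gen a = LatticeGroup.⋀ Lorenzen (λ i → gen (a i))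

  ⋁gen : ∀ {l} → (Fin (suc l) → Carrier) → Term
  ⋁gen b = LatticeGroup.⋁ Lorenzen (λ j → gen (b j))

  atoms-⋀gen : ∀ {k} (a : Fin (suc k) → Carrier) {x} → x ∈ atoms (⋀gen a) → Σ (Fin (suc k)) λ i → x ≡ a i
  atoms-⋀gen {zero} a (here e) = zero , e
  atoms-⋀gen {suc k} a p with MP.∈-++⁻ (a zero ∷ []) p
  ... | inj₁ (here e) = zero , e
  ... | inj₂ q = let i , e = atoms-⋀gen (λ i → a (suc i)) q in suc i , e

  atoms-⋁gen : ∀ {k} (a : Fin (suc k) → Carrier) {x} → x ∈ atoms (⋁gen a) → Σ (Fin (suc k)) λ i → x ≡ a i
  atoms-⋁gen {zero} a (here e) = zero , e
  atoms-⋁gen {suc k} a p with MP.∈-++⁻ (a zero ∷ []) p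
  ... | inj₁ (here e) = zero , e
  ... | inj₂ q = let i , e = atoms-⋁gen (λ i → a (suc i)) q in suc i , e

  -- ⋀gen a has a single DNF clause and ⋁gen b a single CNF clause, both made of the generators.
  Below⇒MultiplicityCertificate : ∀ {k l} (a : Fin (suc k) → Carrier) (b : Fin (suc l) → Carrier) →
                                  Below _▷s_ (⋀gen a) (⋁gen b) → MultiplicityCertificate a b
  Below⇒MultiplicityCertificate a b p with Below⇒Certified p (here refl) (here refl)
  ... | certificate as bs asA bsB len ne le
    with indices a as (All.map (λ q → atoms-⋀gen a (dnf-atoms (⋀gen a) (here refl) q)) asA)
       | indices b bs (All.map (λ q → atoms-⋁gen b (cnf-atoms (⋁gen b) (here refl) q)) bsB)
  ... | is , refl | js , refl =
    multiplicities a b is js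
      (P.trans (P.sym (LP.length-map a is)) (P.trans len (LP.length-map b js)))
      (P.subst (1 ≤ℕ_) (LP.length-map a is) ne) le

  module _ (H : LatticeGroup ℓ ℓ ℓ) (φ : Carrier → LatticeGroup.Carrier H) (free : IsFreeLatticeGroupOn G H φ) where
    private
      module H = LatticeGroupProperties H
      φ-isMorphism : IsOrderedGroupMorphism G (LatticeGroup.orderedGroup H) φ
      φ-isMorphism = proj₁ free
    open OrderedGroupMorphismProperties G (LatticeGroup.orderedGroup H) φ φ-isMorphism using (f-0#)

    MultiplicityCertificate⇒⋀≤⋁ : ∀ {k l} (a : Fin (suc k) → Carrier) (b : Fin (suc l) → Carrier) →
                                  MultiplicityCertificate a b → H.⋀ (λ i → φ (a i)) H.≤ H.⋁ (λ j → φ (b j))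
    MultiplicityCertificate⇒⋀≤⋁ a b (n , m , eq , pos , le) =
      certificate-bound H φ φ-isMorphism (expand n a) (expand m b)
        (All-expand n a (H.⋀-lb (λ i → φ (a i))))
        (All-expand m b (H.⋁-ub (λ j → φ (b j))))
        (P.trans (length-expand n a) (P.trans eq (P.sym (length-expand m b))))
        (P.subst (1 ≤ℕ_) (P.sym (length-expand n a)) pos)
        (≤-resp (≈-sym (sumL-expand n a)) (≈-sym (sumL-expand m b)) le)

    -- Freeness provides a lattice-group morphism θ : H → Lorenzen over G, which carries the inequality
    -- to the Lorenzen group, where it is decided by certificates.
    ⋀≤⋁⇒Below : ∀ {k l} (a : Fin (suc k) → Carrier) (b : Fin (suc l) → Carrier) →
                H.⋀ (λ i → φ (a i)) H.≤ H.⋁ (λ j → φ (b j)) → Below _▷s_ (⋀gen a) (⋁gen b)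
    ⋀≤⋁⇒Below a b h with proj₂ free Lorenzen gen (LorenzenGroupLaw.gen-morphism lorenzenGroupLaw)
    ... | θ , θ-isMorphism , θ∘φ≈gen , _ =
      ≼-trans (proj₂ θ⋀≈⋀gen) (≼-trans (IsOrderedGroupMorphism.mono θ-isOrderedGroupMorphism h) (proj₁ θ⋁≈⋁gen))
      where
      module L = LatticeGroupProperties Lorenzen
      open LatticeGroupMorphismProperties H Lorenzen θ θ-isMorphism
      θ-isOrderedGroupMorphism :
        IsOrderedGroupMorphism (LatticeGroup.orderedGroup H) (LatticeGroup.orderedGroup Lorenzen) θ
      θ-isOrderedGroupMorphism = IsLatticeGroupMorphism.isOrderedGroupMorphism θ-isMorphism
      θ⋀≈⋀gen : θ (H.⋀ (λ i → φ (a i))) L.≈ ⋀gen a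
      θ⋀≈⋀gen = L.≈-trans (θ-⋀ (λ i → φ (a i))) (L.⋀-cong (λ i → θ∘φ≈gen (a i)))
      θ⋁≈⋁gen : θ (H.⋁ (λ j → φ (b j))) L.≈ ⋁gen b
      θ⋁≈⋁gen = L.≈-trans (θ-⋁ (λ j → φ (b j))) (L.⋁-cong (λ j → θ∘φ≈gen (b j)))

    ⋀≤⋁⇔MultiplicityCertificate : ∀ {k l} (a : Fin (suc k) → Carrier) (b : Fin (suc l) → Carrier) →
                                   (H.⋀ (λ i → φ (a i)) H.≤ H.⋁ (λ j → φ (b j))) ⇔ MultiplicityCertificate a b
    ⋀≤⋁⇔MultiplicityCertificate a b =
      mk⇔ (λ h → Below⇒MultiplicityCertificate a b (⋀≤⋁⇒Below a b h)) (MultiplicityCertificate⇒⋀≤⋁ a b)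

    -- The case k = l = 0 with a₀ = 0#: the multiplicities of 0# and of a are then equal.
    0≤⇔positive-multiple : ∀ a → (H.0# H.≤ φ a) ⇔ Σ ℕ (λ n → 0# ≤ (suc n · a))
    0≤⇔positive-multiple a = mk⇔ to from
      where
      single-zero single-a : Fin 1 → Carrier
      single-zero _ = 0#
      single-a _ = a
      positive-multiple : ∀ p q → p ℕ.+ 0 ≡ q ℕ.+ 0 → 1 ≤ℕ p ℕ.+ 0 → (p · 0# + 0#) ≤ (q · a + 0#) →
                          Σ ℕ (λ n → 0# ≤ (suc n · a))
      positive-multiple zero _ _ () _
      positive-multiple (suc p) zero () _ _
      positive-multiple p (suc j) _ _ le = j , ≤-resp (≈-trans (+-idʳ _) (·-zeroʳ p)) (+-idʳ _) le
      to : H.0# H.≤ φ a → Σ ℕ (λ n → 0# ≤ (suc n · a))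
      to h with Below⇒MultiplicityCertificate single-zero single-a
                  (⋀≤⋁⇒Below single-zero single-a (H.≤-respˡ (H.≈-sym f-0#) h))
      ... | n , m , eq , pos , le = positive-multiple (n zero) (m zero) eq pos le
      from : Σ ℕ (λ n → 0# ≤ (suc n · a)) → H.0# H.≤ φ a
      from (j , h) = H.≤-respˡ f-0# (MultiplicityCertificate⇒⋀≤⋁ single-zero single-a
        ((λ _ → suc j) , (λ _ → suc j) , refl , s≤s z≤n ,
         ≤-resp (≈-sym (≈-trans (+-idʳ _) (·-zeroʳ (suc j)))) (≈-sym (+-idʳ _)) h))


open import Level using (Level)
open import Data.Nat using (ℕ; suc; _≤_)
open import Data.Fin using (Fin)
open import Data.Product using (Σ; _×_; _,_)
open import Relation.Binary.PropositionalEquality using (_≡_)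
open import Function.Bundles using (_⇔_)

theorem4p15 : ∀ {ℓ : Level} (G : OrderedGroup ℓ ℓ ℓ) →
    (∀ (H : LatticeGroup ℓ ℓ ℓ) (φ : OrderedGroup.Carrier G → LatticeGroup.Carrier H) →
       IsFreeLatticeGroupOn G H φ →
       (∀ (a : OrderedGroup.Carrier G) →
          (LatticeGroup._≤_ H (LatticeGroup.0# H) (φ a))
          ⇔ Σ ℕ (λ n → OrderedGroup._≤_ G (OrderedGroup.0# G) (OrderedGroup._·_ G (suc n) a)))
       ×
       (∀ (k l : ℕ) (a : Fin (suc k) → OrderedGroup.Carrier G) (b : Fin (suc l) → OrderedGroup.Carrier G) →
          (LatticeGroup._≤_ H (LatticeGroup.⋀ H (λ i → φ (a i))) (LatticeGroup.⋁ H (λ j → φ (b j))))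
          ⇔ Σ (Fin (suc k) → ℕ) (λ n → Σ (Fin (suc l) → ℕ) (λ m →
               (sumℕ n ≡ sumℕ m) × (1 ≤ sumℕ n) ×
               OrderedGroup._≤_ G (OrderedGroup.∑ G (λ i → OrderedGroup._·_ G (n i) (a i)))
                                  (OrderedGroup.∑ G (λ j → OrderedGroup._·_ G (m j) (b j)))))))
    ×
    Σ (Lorenzen.LorenzenGroupLaw G (Lorenzen._▷s_ G)) (λ L →
       IsFreeLatticeGroupOn G (Lorenzen.LorenzenGroupLaw.latticeGroup L) (λ x → Lorenzen.gen {G = G} x))
theorem4p15 G =
  (λ H φ free → 0≤⇔positive-multiple H φ free , λ k l → ⋀≤⋁⇔MultiplicityCertificate H φ free) ,
  lorenzenGroupLaw , lorenzen-isFree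
  where
  open Characterisation G using (0≤⇔positive-multiple; ⋀≤⋁⇔MultiplicityCertificate)
  open LorenzenConstruction G using (lorenzenGroupLaw)
  open LorenzenUniversality G using (lorenzen-isFree)
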